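{- For every integer $n\geq 3$, the number of spanning quasi-trees of the bouquet $\mathbb{F}'^{n}_n$ is the $n$-th Lucas number: $\kappa(\mathbb{F}'^{n}_n)=\ell_n$.
   Context: A bouquet is a ribbon graph (surface with boundary made of vertex discs and edge ribbons) with exactly one vertex. A quasi-tree is a ribbon graph with exactly one boundary component; $\kappa(G)$ is the number of $F\subseteq E(G)$ such that the spanning ribbon subgraph $(V(G),F)$ (delete edges outside $F$) is a quasi-tree. A bouquet with edges $1,\dots,n$ is given by a signed rotation: a cyclic sequence in which each label occurs twice, recording the order in which the edge ends meet the vertex boundary; occurrences may carry a minus sign (plus omitted), and edge $i$ is an orientable loop iff its two occurrences have the same sign, non-orientable otherwise. For $n\geq3$, $\mathbb{F}'^{n}_n$ has signed rotation consisting of $1,2,3,2,1$, followed by $i,i-1$ for $i=4,\dots,n$, followed by $-n$, i.e. $(1,2,3,2,1,4,3,5,4,\dots,n,n-1,-n)$ (for $n=3$: $(1,2,3,2,1,-3)$); only edge $n$ is non-orientable. Lucas numbers: $\ell_1=1,\ell_2=3$, $\ell_k=\ell_{k-1}+\ell_{k-2}$. -}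

module Defs where

open import Data.Nat using (ℕ; zero; suc; _+_; _*_; _∸_; _≤ᵇ_; _≡ᵇ_)
open import Data.Nat.DivMod using (_/_; _%_)
open import Data.Bool using (Bool; true; false; if_then_else_; _∧_; not)
open import Data.Product using (_×_; _,_; proj₁; proj₂)
open import Data.List using (List; []; _∷_; _++_; map; length; filter; upTo; concatMap)
open import Data.Vec using ([]; _∷_)
open import Data.Fin.Subset using (Subset; Side; inside; outside)

-- Signed rotations of bouquets.
-- An entry (e , s) is an end of edge e (edges labelled 1,2,...), with
-- sign s (true = +, false = -).  The list is read cyclically.

SignedRotation : Set
SignedRotation = List (ℕ × Bool)

Fprime : ℕ → SignedRotation
Fprime n =
  ((1 , true) ∷ (2 , true) ∷ (3 , true) ∷ (2 , true) ∷ (1 , true) ∷ [])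
  ++ concatMap (λ j → (4 + j , true) ∷ (3 + j , true) ∷ []) (upTo (n ∸ 3))
  ++ ((n , false) ∷ [])

-- Spanning sub-bouquets: keep exactly the edges in F ⊆ {1,...,n}.
-- Edge label i (1 ≤ i ≤ n) corresponds to position i-1 of the subset.

memb : ∀ {n} → Subset n → ℕ → Bool
memb []            _             = false
memb (x ∷ F)       zero          = false
memb (inside ∷ F)  (suc zero)    = true
memb (outside ∷ F) (suc zero)    = false
memb (x ∷ F)       (suc (suc k)) = memb F (suc k)

restrict : ∀ {n} → Subset n → SignedRotation → SignedRotation
restrict F r = filter (λ es → memb F (proj₁ es) Data.Bool.≟ true) r

-- Let L be the length of the rotation (positions 0..L-1).  Each
-- position p (an edge end on the vertex boundary) has a left side
-- (point 2p) and a right side (point 2p+1).  The boundary of the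
-- ribbon graph is the union of
--   * vertex arcs  : right side of p  —  left side of p+1 (mod L),
--   * edge sides   : for the edge whose ends are at p and q,
--       untwisted (equal signs):  R(p) — L(q),  L(p) — R(q),
--       twisted   (signs differ): R(p) — R(q),  L(p) — L(q).
-- These two perfect matchings on the 2L side points form disjoint
-- cycles; the boundary components are exactly these cycles.
-- A bouquet with no edges is a disc: one boundary component.


entry : SignedRotation → ℕ → ℕ × Bool
entry []       _       = (0 , true)
entry (x ∷ xs) zero    = x
entry (x ∷ xs) (suc k) = entry xs k

partner : SignedRotation → ℕ → ℕ
partner r p = go (upTo (length r))
  where
  go : List ℕ → ℕ
  go []       = p
  go (q ∷ qs) = if not (q ≡ᵇ p) ∧ (proj₁ (entry r q) ≡ᵇ proj₁ (entry r p))
                then q else go qs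

sameSign : Bool → Bool → Bool
sameSign true  true  = true
sameSign false false = true
sameSign _     _     = false

twisted : SignedRotation → ℕ → Bool
twisted r p = not (sameSign (proj₂ (entry r p)) (proj₂ (entry r (partner r p))))

sidePt : ℕ → Bool → ℕ
sidePt p false = 2 * p
sidePt p true  = suc (2 * p)

isRight : ℕ → Bool
isRight x = x % 2 ≡ᵇ 1

posOf : ℕ → ℕ
posOf x = x / 2

-- vertex-arc matching (for a rotation of length suc k)
arcMatch : ℕ → ℕ → ℕ
arcMatch k x with isRight x
... | true  = sidePt ((suc (posOf x)) % suc k) false
... | false = sidePt ((posOf x + k) % suc k) true

edgeMatch : SignedRotation → ℕ → ℕ
edgeMatch r x =
  sidePt (partner r (posOf x))
         (if twisted r (posOf x) then isRight x else not (isRight x))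

walk : SignedRotation → ℕ → ℕ → ℕ → List ℕ
walk r k zero    x = x ∷ []
walk r k (suc m) x = x ∷ arcMatch k x ∷ walk r k m (edgeMatch r (arcMatch k x))

-- the boundary cycle through x (every cycle has at most 2L points)
cycleOf : SignedRotation → ℕ → ℕ → List ℕ
cycleOf r k x = walk r k (2 * length r) x

isRep : SignedRotation → ℕ → ℕ → Bool
isRep r k x = allB (λ y → x ≤ᵇ y) (cycleOf r k x)
  where
  allB : (ℕ → Bool) → List ℕ → Bool
  allB f []       = true
  allB f (y ∷ ys) = f y ∧ allB f ys

countTrue : List Bool → ℕ
countTrue []           = 0
countTrue (true ∷ bs)  = suc (countTrue bs)
countTrue (false ∷ bs) = countTrue bs

boundaryComponents : SignedRotation → ℕ
boundaryComponents [] = 1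
boundaryComponents r@(_ ∷ rs) =
  countTrue (map (isRep r (length rs)) (upTo (2 * length r)))

isQuasiTree : SignedRotation → Bool
isQuasiTree r = boundaryComponents r ≡ᵇ 1

allSubsets : (n : ℕ) → List (Subset n)
allSubsets zero    = [] ∷ []
allSubsets (suc n) = map (inside ∷_) (allSubsets n) ++ map (outside ∷_) (allSubsets n)

kappa : (n : ℕ) → SignedRotation → ℕ
kappa n r = countTrue (map (λ F → isQuasiTree (restrict F r)) (allSubsets n))

lucas : ℕ → ℕ
lucas zero          = 2
lucas (suc zero)    = 1
lucas (suc (suc k)) = lucas (suc k) + lucas k

{-# OPTIONS --safe #-}
module Submission where

-- Write κ′ j and κ j for the number of spanning quasi-trees of F′ⁿₙ and of its
-- orientable counterpart Fⁿₙ (n = 3 + j).  Splitting the spanning subgraphs according to the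
-- last one or two edges gives κ′ (j + 1) = κ′ j + κ j and κ (j + 2) = κ (j + 1) + κ j, and the
-- initial values are computed, so both are Lucas sequences.  The splitting rests on surgery at
-- the end of a signed rotation: deleting a twisted loop or a handle (two interlaced untwisted
-- loops) that no other edge crosses keeps the number of boundary components; so does deleting
-- a twisted loop, or a handle, crossed by one further edge x, where in the first case x becomes
-- twisted; deleting an untwisted loop that no edge crosses removes one component.  Each surgery
-- is checked on the boundary walks of the two rotations, which share a prefix: maps between
-- their side points that fix the prefix and carry steps to paths show that the prefix holds
-- the same component representatives in both, and the representatives among the remaining
-- side points are found by explicit walks.

open import Defs
open import Data.Bool using (Bool; true; false; if_then_else_; not; _∧_; T)
open import Data.Bool.ListAction using (all)
open import Data.Bool.Properties using (T-∧)
open import Data.Empty using (⊥; ⊥-elim)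
open import Data.Fin using (toℕ; fromℕ<)
open import Data.Fin.Properties using (pigeonhole; toℕ-fromℕ<; toℕ<n)
open import Data.Fin.Subset using (Subset; Side; inside; outside)
open import Data.List using (List; []; _∷_; _++_; length; upTo; map; concatMap)
open import Data.List.Membership.Propositional using (_∈_)
open import Data.List.Membership.Propositional.Properties using (∈-upTo⁺; ∈-upTo⁻)
open import Data.List.Properties using (upTo-∷ʳ; ++-assoc; ++-identityʳ; length-++; length-map; map-++; map-∘; map-cong; map-cong-local; filter-++; concatMap-++)
open import Data.List.Relation.Unary.All as All using (All; []; _∷_)
open import Data.List.Relation.Unary.All.Properties using (all⁺; all⁻; applyUpTo⁺₁; ++⁺)
open import Data.List.Relation.Unary.Any using (here; there)
open import Data.Nat
open import Data.Nat.DivMod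
open import Data.Nat.GeneralisedArithmetic using (fold; fold-+)
open import Data.Nat.Properties
open import Algebra.Properties.CommutativeSemigroup +-commutativeSemigroup using (interchange)
open import Data.Product using (Σ; ∃₂; _×_; _,_; proj₁; proj₂; map₁; swap)
open import Data.Sum as Sum using (_⊎_; inj₁; inj₂)
open import Data.Unit using (tt)
open import Data.Vec using ([]; _∷_; _∷ʳ_)
open import Function using (_∘_)
open import Function.Bundles using (Equivalence)
open import Relation.Binary.Construct.Closure.ReflexiveTransitive using (Star; ε; _◅_; _◅◅_)
open import Relation.Binary.Definitions using (tri<; tri≈; tri>)
open import Relation.Binary.PropositionalEquality
open import Relation.Nullary using (¬_; yes; no)
open import Relation.Nullary.Decidable using (dec-true; dec-false)


-- Side points, labels and partners

≡ᵇ-refl : ∀ m → (m ≡ᵇ m) ≡ true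
≡ᵇ-refl m = dec-true (m ≟ m) refl

≢⇒≡ᵇ-false : ∀ {m n} → m ≢ n → (m ≡ᵇ n) ≡ false
≢⇒≡ᵇ-false {m} {n} = dec-false (m ≟ n)

posOf-sidePt : ∀ p b → posOf (sidePt p b) ≡ p
posOf-sidePt p false = trans (cong (_/ 2) (*-comm 2 p)) (m*n/n≡m p 2)
posOf-sidePt p true  = begin
  (1 + 2 * p) / 2        ≡⟨ cong (λ z → (1 + z) / 2) (*-comm 2 p) ⟩
  (1 + p * 2) / 2        ≡⟨ +-distrib-/ 1 (p * 2) (subst (λ z → 1 + z < 2) (sym (m*n%n≡0 p 2)) ≤-refl) ⟩
  0 + p * 2 / 2          ≡⟨ m*n/n≡m p 2 ⟩
  p                      ∎
  where open ≡-Reasoning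

isRight-sidePt : ∀ p b → isRight (sidePt p b) ≡ b
isRight-sidePt p false = trans (cong (λ z → z % 2 ≡ᵇ 1) (*-comm 2 p)) (cong (_≡ᵇ 1) (m*n%n≡0 p 2))
isRight-sidePt p true  = trans (cong (λ z → suc z % 2 ≡ᵇ 1) (*-comm 2 p)) (cong (_≡ᵇ 1) ([m+kn]%n≡m%n 1 p 2))

sidePt-onto : ∀ x → ∃₂ λ p b → x ≡ sidePt p b
sidePt-onto zero          = 0 , false , refl
sidePt-onto (suc zero)    = 0 , true , refl
sidePt-onto (suc (suc x)) with sidePt-onto x
... | p , false , refl = suc p , false , sym (*-suc 2 p)
... | p , true  , refl = suc p , true  , cong suc (sym (*-suc 2 p))

sidePt< : ∀ {p L} b → p < L → sidePt p b < 2 * L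
sidePt< false p<L = *-monoʳ-< 2 p<L
sidePt< {p} true p<L = ≤-trans (≤-reflexive (sym (*-suc 2 p))) (*-monoʳ-≤ 2 p<L)

sidePt<⁻ : ∀ {p L} b → sidePt p b < 2 * L → p < L
sidePt<⁻ {p} {L} b lt = *-cancelˡ-< 2 p L (≤-<-trans (2p≤ b) lt)
  where
  2p≤ : ∀ b → 2 * p ≤ sidePt p b
  2p≤ false = ≤-refl
  2p≤ true  = n≤1+n _

label : SignedRotation → ℕ → ℕ
label r q = proj₁ (entry r q)

sign : SignedRotation → ℕ → Bool
sign r q = proj₂ (entry r q)

Occurrence : SignedRotation → ℕ → ℕ → Set
Occurrence r l p = p < length r × label r p ≡ l

multiplicity : SignedRotation → ℕ → ℕ
multiplicity []            l = 0
multiplicity ((a , _) ∷ r) l = if a ≡ᵇ l then suc (multiplicity r l) else multiplicity r l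

multiplicity-here : ∀ {a l} s r → a ≡ l → multiplicity ((a , s) ∷ r) l ≡ suc (multiplicity r l)
multiplicity-here {a} s r refl rewrite ≡ᵇ-refl a = refl

multiplicity-there : ∀ {a l} s r → a ≢ l → multiplicity ((a , s) ∷ r) l ≡ multiplicity r l
multiplicity-there s r a≢l rewrite ≢⇒≡ᵇ-false a≢l = refl

multiplicity-++ : ∀ u t l → multiplicity (u ++ t) l ≡ multiplicity u l + multiplicity t l
multiplicity-++ []            t l = refl
multiplicity-++ ((a , s) ∷ u) t l with a ≟ l
... | yes a≡l rewrite multiplicity-here s (u ++ t) a≡l | multiplicity-here s u a≡l = cong suc (multiplicity-++ u t l)
... | no  a≢l rewrite multiplicity-there s (u ++ t) a≢l | multiplicity-there s u a≢l = multiplicity-++ u t l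

multiplicity-∷ : ∀ x r l → multiplicity r l ≤ multiplicity (x ∷ r) l
multiplicity-∷ (a , s) r l with a ≟ l
... | yes a≡l = ≤-trans (n≤1+n _) (≤-reflexive (sym (multiplicity-here s r a≡l)))
... | no  a≢l = ≤-reflexive (sym (multiplicity-there s r a≢l))

occurrence⇒multiplicity≥1 : ∀ r {l p} → Occurrence r l p → 1 ≤ multiplicity r l
occurrence⇒multiplicity≥1 ((a , s) ∷ r) {p = zero}  (_ , a≡l)   =
  ≤-trans (s≤s z≤n) (≤-reflexive (sym (multiplicity-here s r a≡l)))
occurrence⇒multiplicity≥1 (x ∷ r)       {p = suc p} (p< , lab) =
  ≤-trans (occurrence⇒multiplicity≥1 r (≤-pred p< , lab)) (multiplicity-∷ x r _)

multiplicity-absent : ∀ {l} t → All (λ x → proj₁ x ≢ l) t → multiplicity t l ≡ 0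
multiplicity-absent []            []          = refl
multiplicity-absent ((a , s) ∷ t) (a≢l ∷ ≢l) = trans (multiplicity-there s t a≢l) (multiplicity-absent t ≢l)

multiplicity≡0⇒≢label : ∀ u {e p} → multiplicity u e ≡ 0 → p < length u → e ≢ label u p
multiplicity≡0⇒≢label u none p< e≡ = <-irrefl (sym none) (occurrence⇒multiplicity≥1 u (p< , sym e≡))

multiplicity≥1⇒occurrence : ∀ r {l} → 1 ≤ multiplicity r l → Σ ℕ (Occurrence r l)
multiplicity≥1⇒occurrence ((a , s) ∷ r) {l} m≥1 with a ≟ l
... | yes a≡l = 0 , s≤s z≤n , a≡l
... | no  a≢l with multiplicity≥1⇒occurrence r (subst (1 ≤_) (multiplicity-there s r a≢l) m≥1)
...   | q , q< , lab = suc q , s≤s q< , lab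

two-occurrences : ∀ r {l p q} → Occurrence r l p → Occurrence r l q → p ≢ q → 2 ≤ multiplicity r l
two-occurrences ((a , s) ∷ r) {p = zero} {zero} _ _ p≢q = ⊥-elim (p≢q refl)
two-occurrences ((a , s) ∷ r) {p = zero} {suc q} (_ , a≡l) (q< , lab) _ =
  ≤-trans (s≤s (occurrence⇒multiplicity≥1 r (≤-pred q< , lab))) (≤-reflexive (sym (multiplicity-here s r a≡l)))
two-occurrences ((a , s) ∷ r) {p = suc p} {zero} (p< , lab) (_ , a≡l) _ =
  ≤-trans (s≤s (occurrence⇒multiplicity≥1 r (≤-pred p< , lab))) (≤-reflexive (sym (multiplicity-here s r a≡l)))
two-occurrences (x ∷ r) {p = suc p} {suc q} (p< , lp) (q< , lq) p≢q =
  ≤-trans (two-occurrences r (≤-pred p< , lp) (≤-pred q< , lq) (p≢q ∘ cong suc)) (multiplicity-∷ x r _)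

private
  head+two : ∀ {a l q z} s r → a ≡ l → Occurrence r l q → Occurrence r l z → q ≢ z →
             3 ≤ multiplicity ((a , s) ∷ r) l
  head+two s r a≡l oq oz q≢z = ≤-trans (s≤s (two-occurrences r oq oz q≢z)) (≤-reflexive (sym (multiplicity-here s r a≡l)))

three-occurrences : ∀ r {l p q z} → Occurrence r l p → Occurrence r l q → Occurrence r l z →
                    p ≢ q → q ≢ z → p ≢ z → 3 ≤ multiplicity r l
three-occurrences r {p = zero} {zero} _ _ _ p≢q _ _ = ⊥-elim (p≢q refl)
three-occurrences r {p = zero} {suc q} {zero} _ _ _ _ _ p≢z = ⊥-elim (p≢z refl)
three-occurrences r {p = suc p} {zero} {zero} _ _ _ _ q≢z _ = ⊥-elim (q≢z refl)
three-occurrences ((a , s) ∷ r) {p = zero} {suc q} {suc z} (_ , a≡l) (q< , lq) (z< , lz) _ q≢z _ =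
  head+two s r a≡l (≤-pred q< , lq) (≤-pred z< , lz) (q≢z ∘ cong suc)
three-occurrences ((a , s) ∷ r) {p = suc p} {zero} {suc z} (p< , lp) (_ , a≡l) (z< , lz) _ _ p≢z =
  head+two s r a≡l (≤-pred p< , lp) (≤-pred z< , lz) (p≢z ∘ cong suc)
three-occurrences ((a , s) ∷ r) {p = suc p} {suc q} {zero} (p< , lp) (q< , lq) (_ , a≡l) p≢q _ _ =
  head+two s r a≡l (≤-pred p< , lp) (≤-pred q< , lq) (p≢q ∘ cong suc)
three-occurrences (x ∷ r) {p = suc p} {suc q} {suc z} (p< , lp) (q< , lq) (z< , lz) p≢q q≢z p≢z =
  ≤-trans (three-occurrences r (≤-pred p< , lp) (≤-pred q< , lq) (≤-pred z< , lz)
                             (p≢q ∘ cong suc) (q≢z ∘ cong suc) (p≢z ∘ cong suc))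
          (multiplicity-∷ x r _)

multiplicity≡1⇒unique : ∀ r {l p q} → multiplicity r l ≡ 1 → Occurrence r l p → Occurrence r l q → p ≡ q
multiplicity≡1⇒unique r {p = p} {q} m≡1 op oq with p ≟ q
... | yes p≡q = p≡q
... | no  p≢q = ⊥-elim (<-irrefl (sym m≡1) (two-occurrences r op oq p≢q))

multiplicity≡2⇒unique-other : ∀ r {l p q z} → multiplicity r l ≡ 2 →
  Occurrence r l p → Occurrence r l q → Occurrence r l z → q ≢ p → z ≢ p → z ≡ q
multiplicity≡2⇒unique-other r {q = q} {z} m≡2 op oq oz q≢p z≢p with z ≟ q
... | yes z≡q = z≡q
... | no  z≢q = ⊥-elim (<-irrefl (sym m≡2) (three-occurrences r op oq oz (q≢p ∘ sym) (z≢q ∘ sym) (z≢p ∘ sym)))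

multiplicity≥2⇒other : ∀ r {l p} → 2 ≤ multiplicity r l → Occurrence r l p → Σ ℕ λ q → Occurrence r l q × q ≢ p
multiplicity≥2⇒other ((a , s) ∷ r) {p = zero} m≥2 (_ , a≡l)
  with multiplicity≥1⇒occurrence r (≤-pred (subst (2 ≤_) (multiplicity-here s r a≡l) m≥2))
... | q , q< , lab = suc q , (s≤s q< , lab) , λ ()
multiplicity≥2⇒other ((a , s) ∷ r) {l} {suc p} m≥2 op with a ≟ l
... | yes a≡l = 0 , (s≤s z≤n , a≡l) , λ ()
... | no  a≢l with multiplicity≥2⇒other r (subst (2 ≤_) (multiplicity-there s r a≢l) m≥2) (≤-pred (proj₁ op) , proj₂ op)
...   | q , (q< , lab) , q≢p = suc q , (s≤s q< , lab) , q≢p ∘ suc-injective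

firstMatch : (ℕ → Bool) → ℕ → List ℕ → ℕ
firstMatch P d []       = d
firstMatch P d (q ∷ qs) = if P q then q else firstMatch P d qs

firstMatch-unfold : ∀ {P d} (G : List ℕ → ℕ) → G [] ≡ d →
  (∀ q qs → G (q ∷ qs) ≡ (if P q then q else G qs)) → ∀ qs → G qs ≡ firstMatch P d qs
firstMatch-unfold G G[] G∷ []       = G[]
firstMatch-unfold G G[] G∷ (q ∷ qs) rewrite G∷ q qs | firstMatch-unfold G G[] G∷ qs = refl

firstMatch-unique : ∀ {P d x} qs → x ∈ qs → T (P x) → (∀ q → q ∈ qs → T (P q) → q ≡ x) → firstMatch P d qs ≡ x
firstMatch-unique {P} {x = x} (q ∷ qs) x∈ Px unique with P q in Pq
... | true  = unique q (here refl) (subst T (sym Pq) tt)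
... | false = firstMatch-unique qs (x∈qs x∈) Px (λ q' q'∈ → unique q' (there q'∈))
  where
  x∈qs : x ∈ q ∷ qs → x ∈ qs
  x∈qs (here refl) = ⊥-elim (subst T Pq Px)
  x∈qs (there x∈)  = x∈

isPartnerOf : SignedRotation → ℕ → ℕ → Bool
isPartnerOf r p q = not (q ≡ᵇ p) ∧ (label r q ≡ᵇ label r p)

-- The search in `partner` is a local function that cannot be named here; abstracting over the
-- searched list lets unification find it as `search`.
partner≡firstMatch : ∀ r p → partner r p ≡ firstMatch (isPartnerOf r p) p (upTo (length r))
partner≡firstMatch r p = proof
  where
  search : List ℕ → ℕ
  search = _
  proof : partner r p ≡ firstMatch (isPartnerOf r p) p (upTo (length r))
  proof with upTo (length r)
  ... | qs = firstMatch-unfold search refl (λ _ _ → refl) qs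

isPartnerOf⁺ : ∀ r {p q} → q ≢ p → label r q ≡ label r p → T (isPartnerOf r p q)
isPartnerOf⁺ r {p} q≢p same rewrite ≢⇒≡ᵇ-false q≢p | same | ≡ᵇ-refl (label r p) = tt

isPartnerOf⁻ : ∀ r {p q} → T (isPartnerOf r p q) → q ≢ p × label r q ≡ label r p
isPartnerOf⁻ r {p} {q} t with Equivalence.to T-∧ t
... | q≢ᵇp , sameᵇ = (λ q≡p → subst (T ∘ not) (dec-true (q ≟ p) q≡p) q≢ᵇp) , ≡ᵇ⇒≡ _ _ sameᵇ

partner-unique : ∀ r {p q} → multiplicity r (label r p) ≡ 2 → p < length r →
                 Occurrence r (label r p) q → q ≢ p → partner r p ≡ q
partner-unique r {p} {q} m≡2 p< oq q≢p =
  trans (partner≡firstMatch r p)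
        (firstMatch-unique _ (∈-upTo⁺ (proj₁ oq)) (isPartnerOf⁺ r q≢p (proj₂ oq)) unique)
  where
  unique : ∀ z → z ∈ upTo (length r) → T (isPartnerOf r p z) → z ≡ q
  unique z z∈ t with isPartnerOf⁻ r t
  ... | z≢p , lz = multiplicity≡2⇒unique-other r m≡2 (p< , refl) oq (∈-upTo⁻ z∈ , lz) q≢p z≢p

WellFormed : SignedRotation → Set
WellFormed r = ∀ p → p < length r → multiplicity r (label r p) ≡ 2

partner-other : ∀ r {p} → WellFormed r → p < length r →
                Σ ℕ λ q → Occurrence r (label r p) q × q ≢ p × partner r p ≡ q
partner-other r {p} wf p< with multiplicity≥2⇒other r (≤-reflexive (sym (wf p p<))) (p< , refl)
... | q , oq , q≢p = q , oq , q≢p , partner-unique r (wf p p<) p< oq q≢p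

partner< : ∀ r {p} → WellFormed r → p < length r → partner r p < length r
partner< r wf p< with partner-other r wf p<
... | _ , (q< , _) , _ , refl = q<

partner-involutive : ∀ r {p} → WellFormed r → p < length r → partner r (partner r p) ≡ p
partner-involutive r {p} wf p< with partner-other r wf p<
... | q , (q< , lq) , q≢p , refl = partner-unique r (trans (cong (multiplicity r) lq) (wf p p<)) q< (p< , sym lq) (q≢p ∘ sym)

twisted-partner : ∀ r {p} → WellFormed r → p < length r → twisted r (partner r p) ≡ twisted r p
twisted-partner r {p} wf p< rewrite partner-involutive r wf p< = cong not (sameSign-comm _ _)
  where
  sameSign-comm : ∀ a b → sameSign a b ≡ sameSign b a
  sameSign-comm true  true  = refl
  sameSign-comm true  false = refl
  sameSign-comm false true  = refl
  sameSign-comm false false = refl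

-- Boundary components as orbits of two involutions

private
  arcMatch-onRight : ∀ k x → isRight x ≡ true → arcMatch k x ≡ sidePt (suc (posOf x) % suc k) false
  arcMatch-onRight k x right rewrite right = refl

  arcMatch-onLeft : ∀ k x → isRight x ≡ false → arcMatch k x ≡ sidePt ((posOf x + k) % suc k) true
  arcMatch-onLeft k x left rewrite left = refl

arcMatch-right : ∀ k {p} → p < k → arcMatch k (sidePt p true) ≡ sidePt (suc p) false
arcMatch-right k {p} p<k = begin
  arcMatch k (sidePt p true)                      ≡⟨ arcMatch-onRight k (sidePt p true) (isRight-sidePt p true) ⟩
  sidePt (suc (posOf (sidePt p true)) % suc k) false ≡⟨ cong (λ z → sidePt (suc z % suc k) false) (posOf-sidePt p true) ⟩
  sidePt (suc p % suc k) false                    ≡⟨ cong (λ z → sidePt z false) (m<n⇒m%n≡m (s≤s p<k)) ⟩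
  sidePt (suc p) false                            ∎
  where open ≡-Reasoning

arcMatch-right-last : ∀ k → arcMatch k (sidePt k true) ≡ 0
arcMatch-right-last k = begin
  arcMatch k (sidePt k true)                      ≡⟨ arcMatch-onRight k (sidePt k true) (isRight-sidePt k true) ⟩
  sidePt (suc (posOf (sidePt k true)) % suc k) false ≡⟨ cong (λ z → sidePt (suc z % suc k) false) (posOf-sidePt k true) ⟩
  sidePt (suc k % suc k) false                    ≡⟨ cong (λ z → sidePt z false) (n%n≡0 (suc k)) ⟩
  0                                               ∎
  where open ≡-Reasoning

arcMatch-left : ∀ k {p} → p < k → arcMatch k (sidePt (suc p) false) ≡ sidePt p true
arcMatch-left k {p} p<k = begin
  arcMatch k (sidePt (suc p) false)                 ≡⟨ arcMatch-onLeft k (sidePt (suc p) false) (isRight-sidePt (suc p) false) ⟩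
  sidePt ((posOf (sidePt (suc p) false) + k) % suc k) true
                                                    ≡⟨ cong (λ z → sidePt ((z + k) % suc k) true) (posOf-sidePt (suc p) false) ⟩
  sidePt ((suc p + k) % suc k) true                 ≡⟨ cong (λ z → sidePt (z % suc k) true) (sym (+-suc p k)) ⟩
  sidePt ((p + suc k) % suc k) true                 ≡⟨ cong (λ z → sidePt z true) ([m+n]%n≡m%n p (suc k)) ⟩
  sidePt (p % suc k) true                           ≡⟨ cong (λ z → sidePt z true) (m<n⇒m%n≡m (m<n⇒m<1+n p<k)) ⟩
  sidePt p true                                     ∎
  where open ≡-Reasoning

arcMatch-left-first : ∀ k → arcMatch k 0 ≡ sidePt k true
arcMatch-left-first k = cong (λ z → sidePt z true) (m<n⇒m%n≡m (n<1+n k))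

arcMatch< : ∀ k {x} → x < 2 * suc k → arcMatch k x < 2 * suc k
arcMatch< k {x} x< with sidePt-onto x
... | p , b , refl = bound p b (sidePt<⁻ b x<)
  where
  bound : ∀ p b → p < suc k → arcMatch k (sidePt p b) < 2 * suc k
  bound p true p≤k with m≤n⇒m<n∨m≡n (≤-pred p≤k)
  ... | inj₁ p<k  = subst (_< 2 * suc k) (sym (arcMatch-right k p<k)) (sidePt< false (s≤s p<k))
  ... | inj₂ refl = subst (_< 2 * suc k) (sym (arcMatch-right-last k)) (s≤s z≤n)
  bound zero    false _   = subst (_< 2 * suc k) (sym (arcMatch-left-first k)) (sidePt< true ≤-refl)
  bound (suc p) false p≤k = subst (_< 2 * suc k) (sym (arcMatch-left k (≤-pred p≤k))) (sidePt< true (m<n⇒m<1+n (≤-pred p≤k)))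

arcMatch-involutive : ∀ k {x} → x < 2 * suc k → arcMatch k (arcMatch k x) ≡ x
arcMatch-involutive k {x} x< with sidePt-onto x
... | p , b , refl = involutive p b (sidePt<⁻ b x<)
  where
  involutive : ∀ p b → p < suc k → arcMatch k (arcMatch k (sidePt p b)) ≡ sidePt p b
  involutive p true p≤k with m≤n⇒m<n∨m≡n (≤-pred p≤k)
  ... | inj₁ p<k  = trans (cong (arcMatch k) (arcMatch-right k p<k)) (arcMatch-left k p<k)
  ... | inj₂ refl = trans (cong (arcMatch k) (arcMatch-right-last k)) (arcMatch-left-first k)
  involutive zero    false _   = trans (cong (arcMatch k) (arcMatch-left-first k)) (arcMatch-right-last k)
  involutive (suc p) false p≤k = trans (cong (arcMatch k) (arcMatch-left k (≤-pred p≤k))) (arcMatch-right k (≤-pred p≤k))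

-- Crossing an edge keeps the side of the end iff the edge is twisted.
acrossEdge : Bool → Bool → Bool
acrossEdge twist b = if twist then b else not b

acrossEdge-involutive : ∀ twist b → acrossEdge twist (acrossEdge twist b) ≡ b
acrossEdge-involutive true  b     = refl
acrossEdge-involutive false true  = refl
acrossEdge-involutive false false = refl

edgeMatch-sidePt : ∀ r p b → edgeMatch r (sidePt p b) ≡ sidePt (partner r p) (acrossEdge (twisted r p) b)
edgeMatch-sidePt r p b rewrite posOf-sidePt p b | isRight-sidePt p b = refl

edgeMatch-partner : ∀ r {p q s s′} b → partner r p ≡ q → sign r p ≡ s → sign r q ≡ s′ →
                    edgeMatch r (sidePt p b) ≡ sidePt q (acrossEdge (not (sameSign s s′)) b)
edgeMatch-partner r {p} b refl refl refl = edgeMatch-sidePt r p b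

edgeMatch< : ∀ r {x} → WellFormed r → x < 2 * length r → edgeMatch r x < 2 * length r
edgeMatch< r {x} wf x< with sidePt-onto x
... | p , b , refl =
  subst (_< 2 * length r) (sym (edgeMatch-sidePt r p b)) (sidePt< (acrossEdge (twisted r p) b) (partner< r wf (sidePt<⁻ b x<)))

edgeMatch-involutive : ∀ r {x} → WellFormed r → x < 2 * length r → edgeMatch r (edgeMatch r x) ≡ x
edgeMatch-involutive r {x} wf x< with sidePt-onto x
... | p , b , refl = begin
  edgeMatch r (edgeMatch r (sidePt p b))                 ≡⟨ cong (edgeMatch r) (edgeMatch-sidePt r p b) ⟩
  edgeMatch r (sidePt (partner r p) (acrossEdge t b))    ≡⟨ edgeMatch-sidePt r (partner r p) (acrossEdge t b) ⟩
  sidePt (partner r (partner r p)) (acrossEdge (twisted r (partner r p)) (acrossEdge t b))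
    ≡⟨ cong₂ (λ q t′ → sidePt q (acrossEdge t′ (acrossEdge t b))) (partner-involutive r wf p<) (twisted-partner r wf p<) ⟩
  sidePt p (acrossEdge t (acrossEdge t b))               ≡⟨ cong (sidePt p) (acrossEdge-involutive t b) ⟩
  sidePt p b                                             ∎
  where
  open ≡-Reasoning
  p< = sidePt<⁻ b x<
  t = twisted r p

fold-comm : ∀ (f : ℕ → ℕ) x i → fold (f x) f i ≡ f (fold x f i)
fold-comm f x zero    = refl
fold-comm f x (suc i) = cong f (fold-comm f x i)

fold-periodic : ∀ (f : ℕ → ℕ) {x d} → fold x f d ≡ x → ∀ q → fold x f (q * d) ≡ x
fold-periodic f         h zero    = refl
fold-periodic f {x} {d} h (suc q) = trans (fold-+ x f d) (trans (cong (λ z → fold z f d) (fold-periodic f h q)) h)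

fold-mod : ∀ (f : ℕ → ℕ) {x} p → fold x f (suc p) ≡ x → ∀ i → fold x f i ≡ fold x f (i % suc p)
fold-mod f {x} p h i = begin
  fold x f i                                            ≡⟨ cong (fold x f) (m≡m%n+[m/n]*n i (suc p)) ⟩
  fold x f (i % suc p + i / suc p * suc p)              ≡⟨ fold-+ x f (i % suc p) ⟩
  fold (fold x f (i / suc p * suc p)) f (i % suc p)     ≡⟨ cong (λ z → fold z f (i % suc p)) (fold-periodic f h (i / suc p)) ⟩
  fold x f (i % suc p)                                  ∎
  where open ≡-Reasoning

alternating : (α β : ℕ → ℕ) → ℕ → ℕ → List ℕ
alternating α β zero    x = x ∷ []
alternating α β (suc j) x = x ∷ α x ∷ alternating α β j (β (α x))

module Involutions (N : ℕ) (α β : ℕ → ℕ)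
  (α< : ∀ {x} → x < N → α x < N) (β< : ∀ {x} → x < N → β x < N)
  (α-involutive : ∀ {x} → x < N → α (α x) ≡ x) (β-involutive : ∀ {x} → x < N → β (β x) ≡ x) where

  Step : ℕ → ℕ → Set
  Step x y = y ≡ α x ⊎ y ≡ β x

  Connected : ℕ → ℕ → Set
  Connected = Star Step

  Step< : ∀ {x y} → x < N → Step x y → y < N
  Step< x< (inj₁ refl) = α< x<
  Step< x< (inj₂ refl) = β< x<

  Connected< : ∀ {x y} → x < N → Connected x y → y < N
  Connected< x< ε       = x<
  Connected< x< (s ◅ c) = Connected< (Step< x< s) c

  Step-sym : ∀ {x y} → x < N → Step x y → Step y x
  Step-sym x< (inj₁ refl) = inj₁ (sym (α-involutive x<))
  Step-sym x< (inj₂ refl) = inj₂ (sym (β-involutive x<))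

  Connected-sym : ∀ {x y} → x < N → Connected x y → Connected y x
  Connected-sym x< ε       = ε
  Connected-sym x< (s ◅ c) = Connected-sym (Step< x< s) c ◅◅ (Step-sym x< s ◅ ε)

  infixr 5 _α⟨_⟩_ _β⟨_⟩_
  infix  6 _■

  _α⟨_⟩_ : ∀ x {y z} → α x ≡ y → Connected y z → Connected x z
  x α⟨ refl ⟩ c = inj₁ refl ◅ c

  _β⟨_⟩_ : ∀ x {y z} → β x ≡ y → Connected y z → Connected x z
  x β⟨ refl ⟩ c = inj₂ refl ◅ c

  _■ : ∀ x → Connected x x
  x ■ = ε

  alternating-sound : ∀ j {x y} → y ∈ alternating α β j x → Connected x y
  alternating-sound zero    (here refl)         = ε
  alternating-sound (suc j) (here refl)         = ε
  alternating-sound (suc j) (there (here refl)) = inj₁ refl ◅ ε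
  alternating-sound (suc j) (there (there y∈))  = inj₁ refl ◅ inj₂ refl ◅ alternating-sound j y∈

  σ : ℕ → ℕ
  σ = β ∘ α

  σ^< : ∀ i {x} → x < N → fold x σ i < N
  σ^< zero    x< = x<
  σ^< (suc i) x< = β< (α< (σ^< i x<))

  σ-injective : ∀ {x y} → x < N → y < N → σ x ≡ σ y → x ≡ y
  σ-injective {x} {y} x< y< σx≡σy = begin
    x         ≡⟨ α-involutive x< ⟨
    α (α x)   ≡⟨ cong α (trans (sym (β-involutive (α< x<))) (trans (cong β σx≡σy) (β-involutive (α< y<)))) ⟩
    α (α y)   ≡⟨ α-involutive y< ⟩
    y         ∎
    where open ≡-Reasoning

  σ^-cancel : ∀ {x} → x < N → ∀ i j → i < j → fold x σ i ≡ fold x σ j → fold x σ (j ∸ i) ≡ x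
  σ^-cancel x< zero    j       i<j eq = sym eq
  σ^-cancel x< (suc i) (suc j) i<j eq = σ^-cancel x< i j (≤-pred i<j) (σ-injective (σ^< i x<) (σ^< j x<) eq)

  -- Among σ⁰x, …, σᴺx, all below N, two coincide.
  period : ∀ {x} → x < N → Σ ℕ λ p → p < N × fold x σ (suc p) ≡ x
  period {x} x< with pigeonhole (n<1+n N) (λ i → fromℕ< (σ^< (toℕ i) x<))
  ... | i , j , i<j , same =
    pred d , pred-d<N , subst (λ e → fold x σ e ≡ x) (sym (suc-pred d)) (σ^-cancel x< _ _ i<j σ^i≡σ^j)
    where
    d = toℕ j ∸ toℕ i
    instance
      d≢0 : NonZero d
      d≢0 = >-nonZero (m<n⇒0<n∸m i<j)
    σ^i≡σ^j : fold x σ (toℕ i) ≡ fold x σ (toℕ j)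
    σ^i≡σ^j = trans (sym (toℕ-fromℕ< _)) (trans (cong toℕ same) (toℕ-fromℕ< _))
    pred-d<N : pred d < N
    pred-d<N = <-≤-trans (subst (pred d <_) (suc-pred d) (n<1+n _)) (≤-trans (m∸n≤m (toℕ j) (toℕ i)) (≤-pred (toℕ<n j)))

  InOrbit : ℕ → ℕ → Set
  InOrbit x y = Σ ℕ λ i → y ≡ fold x σ i ⊎ y ≡ α (fold x σ i)

  InOrbit-step : ∀ {x y z} → x < N → InOrbit x y → Step y z → InOrbit x z
  InOrbit-step x< (i     , inj₁ refl) (inj₁ refl) = i , inj₂ refl
  InOrbit-step x< (suc i , inj₁ refl) (inj₂ refl) = i , inj₂ (β-involutive (α< (σ^< i x<)))
  InOrbit-step x< (zero  , inj₁ refl) (inj₂ refl) with period x<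
  ... | p , _ , σ^p+1≡x = p , inj₂ (trans (cong β (sym σ^p+1≡x)) (β-involutive (α< (σ^< p x<))))
  InOrbit-step x< (i     , inj₂ refl) (inj₁ refl) = i , inj₁ (α-involutive (σ^< i x<))
  InOrbit-step x< (i     , inj₂ refl) (inj₂ refl) = suc i , inj₁ refl

  Connected⇒InOrbit : ∀ {x y} → x < N → Connected x y → InOrbit x y
  Connected⇒InOrbit {x} x< = go (0 , inj₁ refl)
    where
    go : ∀ {y z} → InOrbit x y → Connected y z → InOrbit x z
    go o ε       = o
    go o (s ◅ c) = go (InOrbit-step x< o s) c

  alternating-∋ : ∀ j x i → i < j → fold x σ i ∈ alternating α β j x × α (fold x σ i) ∈ alternating α β j x
  alternating-∋ (suc j) x zero    _   = here refl , there (here refl)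
  alternating-∋ (suc j) x (suc i) i<j with alternating-∋ j (σ x) i (≤-pred i<j)
  ... | σ^i∈ , ασ^i∈ = there (there (subst (_∈ alternating α β j (σ x)) (fold-comm σ x i) σ^i∈)) ,
                       there (there (subst (λ z → α z ∈ alternating α β j (σ x)) (fold-comm σ x i) ασ^i∈))

  alternating-complete : ∀ {x y} → x < N → Connected x y → y ∈ alternating α β N x
  alternating-complete {x} {y} x< c with period x< | Connected⇒InOrbit x< c
  ... | p , p<N , σ^p+1≡x | i , y≡
    with fold-mod σ p σ^p+1≡x i | alternating-∋ N x (i % suc p) (<-≤-trans (m%n<n i (suc p)) p<N)
  ... | σ^i≡ | σ^i∈ , ασ^i∈ = member y≡
    where
    member : y ≡ fold x σ i ⊎ y ≡ α (fold x σ i) → y ∈ alternating α β N x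
    member (inj₁ refl) = subst (_∈ alternating α β N x) (sym σ^i≡) σ^i∈
    member (inj₂ refl) = subst (_∈ alternating α β N x) (cong α (sym σ^i≡)) ασ^i∈

walk≡alternating : ∀ r k j x → walk r k j x ≡ alternating (arcMatch k) (edgeMatch r) j x
walk≡alternating r k zero    x = refl
walk≡alternating r k (suc j) x = cong (λ w → x ∷ arcMatch k x ∷ w) (walk≡alternating r k j _)

all-unfold : ∀ {p : ℕ → Bool} (G : List ℕ → Bool) → G [] ≡ true →
  (∀ y ys → G (y ∷ ys) ≡ p y ∧ G ys) → ∀ ys → G ys ≡ all p ys
all-unfold G G[] G∷ []       = G[]
all-unfold G G[] G∷ (y ∷ ys) rewrite G∷ y ys | all-unfold G G[] G∷ ys = refl

-- As for `partner≡firstMatch`: the local `allB` of `isRep` is supplied by unification.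
isRep≡all : ∀ r k x → isRep r k x ≡ all (x ≤ᵇ_) (walk r k (2 * length r) x)
isRep≡all r k x = proof
  where
  allBelow : List ℕ → Bool
  allBelow = _
  proof : isRep r k x ≡ all (x ≤ᵇ_) (walk r k (2 * length r) x)
  proof with walk r k (2 * length r) x
  ... | ys = all-unfold allBelow refl (λ _ _ → refl) ys

isRep⇒≤ : ∀ r k {x y} → isRep r k x ≡ true → y ∈ walk r k (2 * length r) x → x ≤ y
isRep⇒≤ r k {x} rep y∈ = ≤ᵇ⇒≤ x _ (All.lookup (all⁺ (x ≤ᵇ_) _ (subst T (trans (sym rep) (isRep≡all r k x)) tt)) y∈)

≤⇒isRep : ∀ r k {x} → (∀ {y} → y ∈ walk r k (2 * length r) x → x ≤ y) → isRep r k x ≡ true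
≤⇒isRep r k {x} below with isRep r k x in eq
... | true  = refl
... | false =
  ⊥-elim (subst T (trans (sym (isRep≡all r k x)) eq) (all⁻ (x ≤ᵇ_) (All.tabulate (λ y∈ → ≤⇒≤ᵇ (below y∈)))))

module Boundary (a : ℕ × Bool) (rs : SignedRotation) (wf : WellFormed (a ∷ rs)) where

  r : SignedRotation
  r = a ∷ rs

  k N : ℕ
  k = length rs
  N = 2 * length r

  open Involutions N (arcMatch k) (edgeMatch r) (arcMatch< k) (edgeMatch< r wf)
                   (arcMatch-involutive k) (edgeMatch-involutive r wf) public

  isRep⇒minimal : ∀ {x y} → x < N → isRep r k x ≡ true → Connected x y → x ≤ y
  isRep⇒minimal {x} {y} x< rep c =
    isRep⇒≤ r k rep (subst (y ∈_) (sym (walk≡alternating r k N x)) (alternating-complete x< c))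

  minimal⇒isRep : ∀ {x} → (∀ {y} → Connected x y → x ≤ y) → isRep r k x ≡ true
  minimal⇒isRep {x} minimal =
    ≤⇒isRep r k (λ {y} y∈ → minimal (alternating-sound N (subst (y ∈_) (walk≡alternating r k N x) y∈)))

  smaller⇒¬isRep : ∀ {x y} → x < N → Connected x y → y < x → isRep r k x ≡ false
  smaller⇒¬isRep {x} {y} x< c y<x with isRep r k x in rep
  ... | true  = ⊥-elim (<⇒≱ y<x (isRep⇒minimal x< rep c))
  ... | false = refl

  Connected-closed : (S : ℕ → Set) → (∀ {y z} → S y → Step y z → S z) → ∀ {x y} → S x → Connected x y → S y
  Connected-closed S closed Sx ε       = Sx
  Connected-closed S closed Sx (s ◅ c) = Connected-closed S closed (closed Sx s) c

countTrue-++ : ∀ xs ys → countTrue (xs ++ ys) ≡ countTrue xs + countTrue ys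
countTrue-++ []           ys = refl
countTrue-++ (true ∷ xs)  ys = cong suc (countTrue-++ xs ys)
countTrue-++ (false ∷ xs) ys = countTrue-++ xs ys

repCount : SignedRotation → List ℕ → ℕ
repCount r xs = countTrue (map (isRep r (pred (length r))) xs)

repCount-++ : ∀ r xs ys → repCount r (xs ++ ys) ≡ repCount r xs + repCount r ys
repCount-++ r xs ys = trans (cong countTrue (map-++ _ xs ys)) (countTrue-++ (map (isRep r (pred (length r))) xs) _)

repCount-none : ∀ r {xs} → All (λ x → isRep r (pred (length r)) x ≡ false) xs → repCount r xs ≡ 0
repCount-none r All.[]            = refl
repCount-none r (¬rep All.∷ ¬reps) rewrite ¬rep = repCount-none r ¬reps

sides : ℕ → ℕ → List ℕ
sides m zero    = []
sides m (suc c) = sidePt m false ∷ sidePt m true ∷ sides (suc m) c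

upTo-sides : ∀ m c → upTo (2 * (m + c)) ≡ upTo (2 * m) ++ sides m c
upTo-sides m zero    = trans (cong (λ z → upTo (2 * z)) (+-identityʳ m)) (sym (++-identityʳ _))
upTo-sides m (suc c) = begin
  upTo (2 * (m + suc c))                                        ≡⟨ cong (λ z → upTo (2 * z)) (+-suc m c) ⟩
  upTo (2 * (suc m + c))                                        ≡⟨ upTo-sides (suc m) c ⟩
  upTo (2 * suc m) ++ sides (suc m) c                           ≡⟨ cong (λ z → upTo z ++ sides (suc m) c) (*-suc 2 m) ⟩
  upTo (suc (suc (2 * m))) ++ sides (suc m) c                   ≡⟨ cong (_++ sides (suc m) c) upTo-2m+2 ⟩
  (upTo (2 * m) ++ sidePt m false ∷ sidePt m true ∷ []) ++ sides (suc m) c ≡⟨ ++-assoc (upTo (2 * m)) _ _ ⟩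
  upTo (2 * m) ++ sides m (suc c)                               ∎
  where
  open ≡-Reasoning
  upTo-2m+2 : upTo (suc (suc (2 * m))) ≡ upTo (2 * m) ++ sidePt m false ∷ sidePt m true ∷ []
  upTo-2m+2 = trans (sym (upTo-∷ʳ (suc (2 * m))))
                    (trans (cong (_++ suc (2 * m) ∷ []) (sym (upTo-∷ʳ (2 * m)))) (++-assoc (upTo (2 * m)) _ _))

boundaryComponents-split : ∀ a u t →
  boundaryComponents (a ∷ u ++ t) ≡
  repCount (a ∷ u ++ t) (upTo (2 * length (a ∷ u))) + repCount (a ∷ u ++ t) (sides (length (a ∷ u)) (length t))
boundaryComponents-split a u t = begin
  repCount W (upTo (2 * length W))                      ≡⟨ cong (λ z → repCount W (upTo (2 * suc z))) (length-++ u) ⟩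
  repCount W (upTo (2 * (length (a ∷ u) + length t)))   ≡⟨ cong (repCount W) (upTo-sides (length (a ∷ u)) (length t)) ⟩
  repCount W (upTo (2 * length (a ∷ u)) ++ sides (length (a ∷ u)) (length t)) ≡⟨ repCount-++ W (upTo (2 * length (a ∷ u))) _ ⟩
  repCount W (upTo (2 * length (a ∷ u))) + repCount W (sides (length (a ∷ u)) (length t)) ∎
  where
  open ≡-Reasoning
  W = a ∷ u ++ t

boundaryComponents≥1 : ∀ r → 1 ≤ boundaryComponents r
boundaryComponents≥1 []       = s≤s z≤n
boundaryComponents≥1 (a ∷ rs) = head-counted _ (≤⇒isRep (a ∷ rs) (length rs) (λ _ → z≤n))
  where
  head-counted : ∀ {b} bs → b ≡ true → 1 ≤ countTrue (b ∷ bs)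
  head-counted bs refl = s≤s z≤n

-- Renaming edges

firstMatch-cong : ∀ {P Q : ℕ → Bool} d qs → (∀ q → P q ≡ Q q) → firstMatch P d qs ≡ firstMatch Q d qs
firstMatch-cong d []       P≗Q = refl
firstMatch-cong d (q ∷ qs) P≗Q rewrite P≗Q q | firstMatch-cong d qs P≗Q = refl

module SamePattern (r r′ : SignedRotation) (same-length : length r ≡ length r′)
  (same-sign : ∀ p → sign r p ≡ sign r′ p)
  (same-pattern : ∀ p q → (label r p ≡ᵇ label r q) ≡ (label r′ p ≡ᵇ label r′ q)) where

  partner-same : ∀ p → partner r p ≡ partner r′ p
  partner-same p = begin
    partner r p                                              ≡⟨ partner≡firstMatch r p ⟩
    firstMatch (isPartnerOf r p) p (upTo (length r))
      ≡⟨ firstMatch-cong p (upTo (length r)) (λ q → cong (not (q ≡ᵇ p) ∧_) (same-pattern q p)) ⟩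
    firstMatch (isPartnerOf r′ p) p (upTo (length r))        ≡⟨ cong (λ n → firstMatch (isPartnerOf r′ p) p (upTo n)) same-length ⟩
    firstMatch (isPartnerOf r′ p) p (upTo (length r′))       ≡⟨ partner≡firstMatch r′ p ⟨
    partner r′ p                                             ∎
    where open ≡-Reasoning

  edgeMatch-same : ∀ x → edgeMatch r x ≡ edgeMatch r′ x
  edgeMatch-same x rewrite partner-same (posOf x) | same-sign (posOf x) | same-sign (partner r′ (posOf x)) = refl

  walk-same : ∀ k j x → walk r k j x ≡ walk r′ k j x
  walk-same k zero    x = refl
  walk-same k (suc j) x rewrite edgeMatch-same (arcMatch k x) = cong (λ w → x ∷ arcMatch k x ∷ w) (walk-same k j _)

  isRep-same : ∀ k x → isRep r k x ≡ isRep r′ k x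
  isRep-same k x = begin
    isRep r k x                                              ≡⟨ isRep≡all r k x ⟩
    all (x ≤ᵇ_) (walk r k (2 * length r) x)  ≡⟨ cong (all (x ≤ᵇ_)) (walk-same k (2 * length r) x) ⟩
    all (x ≤ᵇ_) (walk r′ k (2 * length r) x) ≡⟨ cong (λ n → all (x ≤ᵇ_) (walk r′ k (2 * n) x)) same-length ⟩
    all (x ≤ᵇ_) (walk r′ k (2 * length r′) x) ≡⟨ isRep≡all r′ k x ⟨
    isRep r′ k x                                             ∎
    where open ≡-Reasoning

boundaryComponents-pattern : ∀ r r′ → length r ≡ length r′ → (∀ p → sign r p ≡ sign r′ p) →
  (∀ p q → (label r p ≡ᵇ label r q) ≡ (label r′ p ≡ᵇ label r′ q)) → boundaryComponents r ≡ boundaryComponents r′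
boundaryComponents-pattern []       []         _   _    _       = refl
boundaryComponents-pattern (a ∷ rs) (a′ ∷ rs′) len sign≗ same-pattern = begin
  countTrue (map (isRep (a ∷ rs) (length rs)) (upTo (2 * length (a ∷ rs))))
    ≡⟨ cong (λ n → countTrue (map (isRep (a ∷ rs) n) (upTo (2 * suc n)))) len′ ⟩
  countTrue (map (isRep (a ∷ rs) (length rs′)) (upTo (2 * length (a′ ∷ rs′))))
    ≡⟨ cong countTrue (map-cong (isRep-same (length rs′)) (upTo (2 * length (a′ ∷ rs′)))) ⟩
  countTrue (map (isRep (a′ ∷ rs′) (length rs′)) (upTo (2 * length (a′ ∷ rs′)))) ∎
  where
  open ≡-Reasoning
  open SamePattern (a ∷ rs) (a′ ∷ rs′) len sign≗ same-pattern
  len′ : length rs ≡ length rs′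
  len′ = suc-injective len

rename : (ℕ → ℕ) → SignedRotation → SignedRotation
rename φ = map (map₁ φ)

label-rename : ∀ φ r p → φ 0 ≡ 0 → label (rename φ r) p ≡ φ (label r p)
label-rename φ []      p       φ0≡0 = sym φ0≡0
label-rename φ (x ∷ r) zero    φ0≡0 = refl
label-rename φ (x ∷ r) (suc p) φ0≡0 = label-rename φ r p φ0≡0

sign-rename : ∀ φ r p → sign (rename φ r) p ≡ sign r p
sign-rename φ []      p       = refl
sign-rename φ (x ∷ r) zero    = refl
sign-rename φ (x ∷ r) (suc p) = sign-rename φ r p

label≤ : ∀ {B} r p → All (λ x → proj₁ x ≤ B) r → label r p ≤ B
label≤ []      p       []          = z≤n
label≤ (x ∷ r) zero    (x≤ ∷ _)   = x≤
label≤ (x ∷ r) (suc p) (_ ∷ r≤)   = label≤ r p r≤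

-- r′ is passed explicitly, as a list in normal form: unifying `boundaryComponents (rename φ r)`
-- with a concrete rotation makes Agda unfold the boundary count.
boundaryComponents-rename : ∀ φ r r′ B → r′ ≡ rename φ r → φ 0 ≡ 0 → All (λ x → proj₁ x ≤ B) r →
  (∀ {i j} → i ≤ B → j ≤ B → φ i ≡ φ j → i ≡ j) → boundaryComponents r′ ≡ boundaryComponents r
boundaryComponents-rename φ r _ B refl φ0≡0 r≤ injective =
  boundaryComponents-pattern (rename φ r) r (length-map _ r) (sign-rename φ r) same-pattern
  where
  same-pattern : ∀ p q → (label (rename φ r) p ≡ᵇ label (rename φ r) q) ≡ (label r p ≡ᵇ label r q)
  same-pattern p q rewrite label-rename φ r p φ0≡0 | label-rename φ r q φ0≡0 with label r p ≟ label r q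
  ... | yes same rewrite same = trans (≡ᵇ-refl (φ (label r q))) (sym (≡ᵇ-refl (label r q)))
  ... | no  diff = trans (≢⇒≡ᵇ-false (diff ∘ injective (label≤ r p r≤) (label≤ r q r≤))) (sym (≢⇒≡ᵇ-false diff))

-- Surgery at the end of a rotation

entry-++ˡ : ∀ u t {q} → q < length u → entry (u ++ t) q ≡ entry u q
entry-++ˡ (x ∷ u) t {zero}  _   = refl
entry-++ˡ (x ∷ u) t {suc q} q<u = entry-++ˡ u t (≤-pred q<u)

entry-++ʳ : ∀ u t i → entry (u ++ t) (i + length u) ≡ entry t i
entry-++ʳ []      t i = cong (entry t) (+-identityʳ i)
entry-++ʳ (x ∷ u) t i = trans (cong (entry (x ∷ u ++ t)) (+-suc i (length u))) (entry-++ʳ u t i)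

bool-ext : ∀ {b c : Bool} → (b ≡ true → c ≡ true) → (c ≡ true → b ≡ true) → b ≡ c
bool-ext {true}  {true}  _ _ = refl
bool-ext {true}  {false} f _ = sym (f refl)
bool-ext {false} {true}  _ g = g refl
bool-ext {false} {false} _ _ = refl

module Prefix (a : ℕ × Bool) (u′ : SignedRotation) where

  u : SignedRotation
  u = a ∷ u′

  n m : ℕ
  n = length u′
  m = length u

  -- Apart from the wrap-around arc at 0, the only arc leaving the prefix starts at lastRight.
  lastRight : ℕ
  lastRight = sidePt n true

  module Extension (t : SignedRotation) where

    W : SignedRotation
    W = a ∷ u′ ++ t

    k c : ℕ
    k = length (u′ ++ t)
    c = length t

    suc-k≡c+m : suc k ≡ c + m
    suc-k≡c+m = trans (cong suc (trans (length-++ u′) (+-comm n c))) (sym (+-suc c n))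

    n≤k : n ≤ k
    n≤k = subst (n ≤_) (sym (length-++ u′)) (m≤m+n n c)

    prefix< : ∀ {p} → p < m → p < length W
    prefix< p<m = <-≤-trans p<m (s≤s n≤k)

    tail< : ∀ {i} → i < c → i + m < length W
    tail< {i} i<c = subst (i + m <_) (sym suc-k≡c+m) (+-monoˡ-< m i<c)

    entry-prefix : ∀ {q} → q < m → entry W q ≡ entry u q
    entry-prefix = entry-++ˡ u t

    entry-tail : ∀ i → entry W (i + m) ≡ entry t i
    entry-tail = entry-++ʳ u t

    arc-prefix-right : ∀ {p} → p < n → arcMatch k (sidePt p true) ≡ sidePt (suc p) false
    arc-prefix-right p<n = arcMatch-right k (<-≤-trans p<n n≤k)

    arc-prefix-left : ∀ {p} → p < n → arcMatch k (sidePt (suc p) false) ≡ sidePt p true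
    arc-prefix-left p<n = arcMatch-left k (<-≤-trans p<n n≤k)

    private
      n<k : 0 < c → n < k
      n<k 0<c = ≤-pred (subst (m <_) (sym suc-k≡c+m) (+-monoˡ-< m 0<c))

      i+m<k : ∀ {i} → suc i < c → i + m < k
      i+m<k {i} i+1<c = ≤-pred (subst (suc i + m <_) (sym suc-k≡c+m) (+-monoˡ-< m i+1<c))

      i+m≡k : ∀ {i} → suc i ≡ c → i + m ≡ k
      i+m≡k i+1≡c = suc-injective (trans (cong (_+ m) i+1≡c) (sym suc-k≡c+m))

      n≡k : c ≡ 0 → n ≡ k
      n≡k c≡0 = suc-injective (trans (cong (_+ m) (sym c≡0)) (sym suc-k≡c+m))

    arc-enter-tail : 0 < c → arcMatch k lastRight ≡ sidePt (0 + m) false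
    arc-enter-tail 0<c = arcMatch-right k (n<k 0<c)

    arc-leave-tail : 0 < c → arcMatch k (sidePt (0 + m) false) ≡ lastRight
    arc-leave-tail 0<c = arcMatch-left k (n<k 0<c)

    arc-tail-right : ∀ i → suc i < c → arcMatch k (sidePt (i + m) true) ≡ sidePt (suc i + m) false
    arc-tail-right i i+1<c = arcMatch-right k (i+m<k i+1<c)

    arc-tail-left : ∀ i → suc i < c → arcMatch k (sidePt (suc i + m) false) ≡ sidePt (i + m) true
    arc-tail-left i i+1<c = arcMatch-left k (i+m<k i+1<c)

    arc-tail-last : ∀ i → suc i ≡ c → arcMatch k (sidePt (i + m) true) ≡ 0
    arc-tail-last i i+1≡c = subst (λ z → arcMatch k (sidePt z true) ≡ 0) (sym (i+m≡k i+1≡c)) (arcMatch-right-last k)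

    arc-first-tail : ∀ i → suc i ≡ c → arcMatch k 0 ≡ sidePt (i + m) true
    arc-first-tail i i+1≡c = subst (λ z → arcMatch k 0 ≡ sidePt z true) (sym (i+m≡k i+1≡c)) (arcMatch-left-first k)

    arc-lastRight-first : c ≡ 0 → arcMatch k lastRight ≡ 0
    arc-lastRight-first c≡0 = subst (λ z → arcMatch k (sidePt z true) ≡ 0) (sym (n≡k c≡0)) (arcMatch-right-last k)

    arc-first-lastRight : c ≡ 0 → arcMatch k 0 ≡ lastRight
    arc-first-lastRight c≡0 = subst (λ z → arcMatch k 0 ≡ sidePt z true) (sym (n≡k c≡0)) (arcMatch-left-first k)

    module Edges (wf : WellFormed W) where

      private
        label-prefix : ∀ {q} → q < m → label W q ≡ label u q
        label-prefix q<m = cong proj₁ (entry-prefix q<m)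

        label-tail : ∀ i → label W (i + m) ≡ label t i
        label-tail i = cong proj₁ (entry-tail i)

        prefix≢tail : ∀ {q} i → q < m → q ≢ i + m
        prefix≢tail i q<m q≡i+m = <-irrefl q≡i+m (<-≤-trans q<m (m≤n+m m i))

        edge : ∀ {p q s s′} b → p < length W → q < length W → q ≢ p → label W q ≡ label W p →
               sign W p ≡ s → sign W q ≡ s′ → edgeMatch W (sidePt p b) ≡ sidePt q (acrossEdge (not (sameSign s s′)) b)
        edge {p} b p< q< q≢p same sp sq = edgeMatch-partner W b (partner-unique W (wf p p<) p< (q< , same) q≢p) sp sq

      edge-tail-tail : ∀ i j b → i < c → j < c → j ≢ i → label t j ≡ label t i →
        edgeMatch W (sidePt (i + m) b) ≡ sidePt (j + m) (acrossEdge (not (sameSign (sign t i) (sign t j))) b)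
      edge-tail-tail i j b i<c j<c j≢i same =
        edge b (tail< i<c) (tail< j<c) (j≢i ∘ +-cancelʳ-≡ m j i)
             (trans (label-tail j) (trans same (sym (label-tail i)))) (cong proj₂ (entry-tail i)) (cong proj₂ (entry-tail j))

      edge-tail-prefix : ∀ i q {s} b → i < c → q < m → label u q ≡ label t i → sign u q ≡ s →
        edgeMatch W (sidePt (i + m) b) ≡ sidePt q (acrossEdge (not (sameSign (sign t i) s)) b)
      edge-tail-prefix i q b i<c q<m same sq =
        edge b (tail< i<c) (prefix< q<m) (prefix≢tail i q<m)
             (trans (label-prefix q<m) (trans same (sym (label-tail i)))) (cong proj₂ (entry-tail i))
             (trans (cong proj₂ (entry-prefix q<m)) sq)

      edge-prefix-tail : ∀ q i {s} b → q < m → i < c → label t i ≡ label u q → sign u q ≡ s →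
        edgeMatch W (sidePt q b) ≡ sidePt (i + m) (acrossEdge (not (sameSign s (sign t i))) b)
      edge-prefix-tail q i b q<m i<c same sq =
        edge b (prefix< q<m) (tail< i<c) (prefix≢tail i q<m ∘ sym)
             (trans (label-tail i) (trans same (sym (label-prefix q<m)))) (trans (cong proj₂ (entry-prefix q<m)) sq)
             (cong proj₂ (entry-tail i))

      multiplicity-prefix : ∀ {p} → p < m → multiplicity t (label u p) ≡ 0 → multiplicity u (label u p) ≡ 2
      multiplicity-prefix {p} p<m none = begin
        multiplicity u (label u p)                            ≡⟨ +-identityʳ _ ⟨
        multiplicity u (label u p) + 0                        ≡⟨ cong (multiplicity u (label u p) +_) none ⟨
        multiplicity u (label u p) + multiplicity t (label u p) ≡⟨ multiplicity-++ u t (label u p) ⟨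
        multiplicity W (label u p)                            ≡⟨ cong (multiplicity W) (label-prefix p<m) ⟨
        multiplicity W (label W p)                            ≡⟨ wf p (prefix< p<m) ⟩
        2                                                     ∎
        where open ≡-Reasoning

      edge-prefix-internal : ∀ {p} b → p < m → multiplicity t (label u p) ≡ 0 →
        Σ ℕ λ q → Occurrence u (label u p) q × q ≢ p ×
                  edgeMatch W (sidePt p b) ≡ sidePt q (acrossEdge (not (sameSign (sign u p) (sign u q))) b)
      edge-prefix-internal {p} b p<m none with multiplicity≥2⇒other u (≤-reflexive (sym (multiplicity-prefix p<m none))) (p<m , refl)
      ... | q , (q<m , same) , q≢p =
        q , (q<m , same) , q≢p ,
        edge b (prefix< p<m) (prefix< q<m) q≢p (trans (label-prefix q<m) (trans same (sym (label-prefix p<m))))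
             (cong proj₂ (entry-prefix p<m)) (cong proj₂ (entry-prefix q<m))

  module Simulation (tA tB : SignedRotation) (wfA : WellFormed (a ∷ u′ ++ tA)) (wfB : WellFormed (a ∷ u′ ++ tB)) where

    module A = Extension tA
    module B = Extension tB
    module ∂A = Boundary a (u′ ++ tA) wfA
    module ∂B = Boundary a (u′ ++ tB) wfB

    private
      prefix<B : ∀ {x} → x < 2 * m → x < ∂B.N
      prefix<B x< = <-≤-trans x< (*-monoʳ-≤ 2 (B.prefix< ≤-refl))

      prefix<A : ∀ {x} → x < 2 * m → x < ∂A.N
      prefix<A x< = <-≤-trans x< (*-monoʳ-≤ 2 (A.prefix< ≤-refl))

      shared-edge : ∀ {p} b → p < m → multiplicity tA (label u p) ≡ 0 → multiplicity tB (label u p) ≡ 0 →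
                    edgeMatch A.W (sidePt p b) ≡ edgeMatch B.W (sidePt p b) × edgeMatch A.W (sidePt p b) < 2 * m
      shared-edge {p} b p<m noneA noneB
        with A.Edges.edge-prefix-internal wfA b p<m noneA | B.Edges.edge-prefix-internal wfB b p<m noneB
      ... | qA , oqA , qA≢p , eA | qB , oqB , qB≢p , eB =
        trans eA (trans (cong (λ q → sidePt q (acrossEdge (not (sameSign (sign u p) (sign u q))) b)) qA≡qB) (sym eB)) ,
        subst (_< 2 * m) (sym eA) (sidePt< (acrossEdge (not (sameSign (sign u p) (sign u qA))) b) (proj₁ oqA))
        where
        qA≡qB : qA ≡ qB
        qA≡qB = multiplicity≡2⇒unique-other u (A.Edges.multiplicity-prefix wfA p<m noneA) (p<m , refl) oqB oqA qB≢p qA≢p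

    -- A step of W_A between prefix points is a step of W_B too, unless it is the arc at lastRight or
    -- at 0, or an edge at a dangling position (one whose partner lies in the tail).
    simulate : (g : ℕ → ℕ) → (∀ {y} → y < 2 * m → g y ≡ y) → (Dangling : ℕ → Set) →
      (∀ {p} → p < m → (multiplicity tA (label u p) ≡ 0 × multiplicity tB (label u p) ≡ 0) ⊎ Dangling p) →
      ∂B.Connected lastRight (g (arcMatch A.k lastRight)) →
      ∂B.Connected 0 (g (arcMatch A.k 0)) →
      (∀ {p} b → Dangling p → ∂B.Connected (sidePt p b) (g (edgeMatch A.W (sidePt p b)))) →
      (∀ {i} b → i < A.c → ∂B.Connected (g (sidePt (i + m) b)) (g (arcMatch A.k (sidePt (i + m) b))) ×
                           ∂B.Connected (g (sidePt (i + m) b)) (g (edgeMatch A.W (sidePt (i + m) b)))) →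
      ∀ {y z} → y < ∂A.N → ∂A.Step y z → ∂B.Connected (g y) (g z)
    simulate g g-prefix Dangling classify last-arc first-arc dangling tail {y} y< step with sidePt-onto y
    ... | p , b , refl with p <? m
    ... | no p≮m = tail-step step
      where
      i = p ∸ m
      i+m≡p : i + m ≡ p
      i+m≡p = m∸n+n≡m (≮⇒≥ p≮m)
      i<c : i < A.c
      i<c = +-cancelʳ-< m i A.c (subst (_< A.c + m) (sym i+m≡p) (subst (p <_) A.suc-k≡c+m (sidePt<⁻ b y<)))
      tail-step : ∀ {z} → ∂A.Step (sidePt p b) z → ∂B.Connected (g (sidePt p b)) (g z)
      tail-step (inj₁ refl) =
        subst (λ q → ∂B.Connected (g (sidePt q b)) (g (arcMatch A.k (sidePt q b)))) i+m≡p (proj₁ (tail b i<c))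
      tail-step (inj₂ refl) =
        subst (λ q → ∂B.Connected (g (sidePt q b)) (g (edgeMatch A.W (sidePt q b)))) i+m≡p (proj₂ (tail b i<c))
    ... | yes p<m = prefix-step p b p<m step
      where
      same-step : ∀ q b {z} → q < m → z < 2 * m → ∂B.Step (sidePt q b) z → ∂B.Connected (g (sidePt q b)) (g z)
      same-step q b q<m z< s = subst₂ ∂B.Connected (sym (g-prefix (sidePt< b q<m))) (sym (g-prefix z<)) (s ◅ ε)

      from-side : ∀ q b {z} → q < m → ∂B.Connected (sidePt q b) (g z) → ∂B.Connected (g (sidePt q b)) (g z)
      from-side q b q<m = subst (λ w → ∂B.Connected w _) (sym (g-prefix (sidePt< b q<m)))

      left-arc : ∀ q → q < m → ∂B.Connected (g (sidePt q false)) (g (arcMatch A.k (sidePt q false)))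
      left-arc zero     q<m = from-side 0 false q<m first-arc
      left-arc (suc q′) q<m =
        same-step (suc q′) false q<m (subst (_< 2 * m) (sym (A.arc-prefix-left (≤-pred q<m))) (sidePt< true (<-trans (n<1+n q′) q<m)))
                  (inj₁ (trans (A.arc-prefix-left (≤-pred q<m)) (sym (B.arc-prefix-left (≤-pred q<m)))))

      prefix-step : ∀ q b → q < m → ∀ {z} → ∂A.Step (sidePt q b) z → ∂B.Connected (g (sidePt q b)) (g z)
      prefix-step q true q<m (inj₁ refl) with m≤n⇒m<n∨m≡n (≤-pred q<m)
      ... | inj₁ q<n  = same-step q true q<m (subst (_< 2 * m) (sym (A.arc-prefix-right q<n)) (sidePt< false (s≤s q<n)))
                                  (inj₁ (trans (A.arc-prefix-right q<n) (sym (B.arc-prefix-right q<n))))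
      ... | inj₂ refl = from-side q true q<m last-arc
      prefix-step q false q<m (inj₁ refl) = left-arc q q<m
      prefix-step q b q<m (inj₂ refl) with classify q<m
      ... | inj₁ (noneA , noneB) =
        same-step q b q<m (proj₂ (shared-edge b q<m noneA noneB)) (inj₂ (proj₁ (shared-edge b q<m noneA noneB)))
      ... | inj₂ d               = from-side q b q<m (dangling b d)

    isRep-transfer : (g : ℕ → ℕ) → (∀ {y} → y < 2 * m → g y ≡ y) →
      (∀ {y z} → y < ∂A.N → ∂A.Step y z → ∂B.Connected (g y) (g z)) →
      ∀ {x} → x < 2 * m → isRep B.W B.k x ≡ true → isRep A.W A.k x ≡ true
    isRep-transfer g g-prefix simulation {x} x<2m repB = ∂A.minimal⇒isRep minimal
      where
      map-path : ∀ {y z} → y < ∂A.N → ∂A.Connected y z → ∂B.Connected (g y) (g z)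
      map-path y< ε       = ε
      map-path y< (s ◅ c) = simulation y< s ◅◅ map-path (∂A.Step< y< s) c
      minimal : ∀ {y} → ∂A.Connected x y → x ≤ y
      minimal {y} c with y <? 2 * m
      ... | yes y<2m = ∂B.isRep⇒minimal (prefix<B x<2m) repB
                         (subst₂ ∂B.Connected (g-prefix x<2m) (g-prefix y<2m) (map-path (prefix<A x<2m) c))
      ... | no  y≮2m = <⇒≤ (<-≤-trans x<2m (≮⇒≥ y≮2m))

  module Move (t₁ t₂ : SignedRotation) (wf₁ : WellFormed (a ∷ u′ ++ t₁)) (wf₂ : WellFormed (a ∷ u′ ++ t₂)) where

    module S₁₂ = Simulation t₁ t₂ wf₁ wf₂
    module S₂₁ = Simulation t₂ t₁ wf₂ wf₁
    module E₁ = Extension t₁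
    module E₂ = Extension t₂
    module ∂₁ = S₁₂.∂A
    module ∂₂ = S₁₂.∂B
    module Edges₁ = E₁.Edges wf₁
    module Edges₂ = E₂.Edges wf₂

    Simulates₁₂ : (ℕ → ℕ) → Set
    Simulates₁₂ g = ∀ {y z} → y < ∂₁.N → ∂₁.Step y z → ∂₂.Connected (g y) (g z)

    Simulates₂₁ : (ℕ → ℕ) → Set
    Simulates₂₁ g = ∀ {y z} → y < ∂₂.N → ∂₂.Step y z → ∂₁.Connected (g y) (g z)

    boundaryComponents-compare : (g f : ℕ → ℕ) → (∀ {y} → y < 2 * m → g y ≡ y) → (∀ {y} → y < 2 * m → f y ≡ y) →
      Simulates₁₂ g → Simulates₂₁ f →
      boundaryComponents E₁.W + repCount E₂.W (sides m E₂.c) ≡ boundaryComponents E₂.W + repCount E₁.W (sides m E₁.c)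
    boundaryComponents-compare g f g-prefix f-prefix sim₁₂ sim₂₁ = begin
      boundaryComponents E₁.W + T₂    ≡⟨ cong (_+ T₂) (boundaryComponents-split a u′ t₁) ⟩
      (P₁ + T₁) + T₂                  ≡⟨ cong (λ z → (z + T₁) + T₂) prefix-agree ⟩
      (P₂ + T₁) + T₂                  ≡⟨ +-assoc P₂ T₁ T₂ ⟩
      P₂ + (T₁ + T₂)                  ≡⟨ cong (P₂ +_) (+-comm T₁ T₂) ⟩
      P₂ + (T₂ + T₁)                  ≡⟨ +-assoc P₂ T₂ T₁ ⟨
      (P₂ + T₂) + T₁                  ≡⟨ cong (_+ T₁) (boundaryComponents-split a u′ t₂) ⟨
      boundaryComponents E₂.W + T₁    ∎
      where
      open ≡-Reasoning
      P₁ = repCount E₁.W (upTo (2 * m))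
      P₂ = repCount E₂.W (upTo (2 * m))
      T₁ = repCount E₁.W (sides m E₁.c)
      T₂ = repCount E₂.W (sides m E₂.c)
      prefix-agree : P₁ ≡ P₂
      prefix-agree = cong countTrue (map-cong-local {f = isRep E₁.W E₁.k} {isRep E₂.W E₂.k}
        (applyUpTo⁺₁ (λ x → x) (2 * m) λ x<2m →
          bool-ext (S₂₁.isRep-transfer f f-prefix sim₂₁ x<2m) (S₁₂.isRep-transfer g g-prefix sim₁₂ x<2m)))

    τ : ℕ → Bool → ℕ
    τ i b = sidePt (i + m) b

    lastRight<2m : lastRight < 2 * m
    lastRight<2m = sidePt< true ≤-refl

    0<2m : 0 < 2 * m
    0<2m = s≤s z≤n

    prefix<₁ : ∀ {x} → x < 2 * m → x < ∂₁.N
    prefix<₁ x< = <-≤-trans x< (*-monoʳ-≤ 2 (E₁.prefix< ≤-refl))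

    τ≮2m : ∀ i b → ¬ τ i b < 2 * m
    τ≮2m i b τ< = <-irrefl refl (<-≤-trans (sidePt<⁻ b τ<) (m≤n+m m i))

    τ-joins₁ : ∀ i b {x} → i < E₁.c → x < 2 * m → ∂₁.Connected (τ i b) x → isRep E₁.W E₁.k (τ i b) ≡ false
    τ-joins₁ i b i<c x<2m c = ∂₁.smaller⇒¬isRep (sidePt< b (E₁.tail< i<c)) c (<-≤-trans x<2m (≮⇒≥ (τ≮2m i b)))

    τ-joins₂ : ∀ i b {x} → i < E₂.c → x < 2 * m → ∂₂.Connected (τ i b) x → isRep E₂.W E₂.k (τ i b) ≡ false
    τ-joins₂ i b i<c x<2m c = ∂₂.smaller⇒¬isRep (sidePt< b (E₂.tail< i<c)) c (<-≤-trans x<2m (≮⇒≥ (τ≮2m i b)))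

    -- The simulating maps fix the prefix and send the tail point τ i b to h i b, a point of the
    -- other rotation on the boundary component that corresponds to the one through τ i b.
    collapse : (ℕ → Bool → ℕ) → ℕ → ℕ
    collapse h y with y <? 2 * m
    ... | yes _ = y
    ... | no  _ = h ((y ∸ 2 * m) / 2) (isRight y)

    collapse-prefix : ∀ h {y} → y < 2 * m → collapse h y ≡ y
    collapse-prefix h {y} y< with y <? 2 * m
    ... | yes _  = refl
    ... | no  y≮ = ⊥-elim (y≮ y<)

    collapse-τ : ∀ h i b → collapse h (τ i b) ≡ h i b
    collapse-τ h i b with τ i b <? 2 * m
    ... | yes τ< = ⊥-elim (τ≮2m i b τ<)
    ... | no  _  = cong₂ h (trans (cong posOf (τ∸2m b)) (posOf-sidePt i b)) (isRight-sidePt (i + m) b)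
      where
      τ∸2m : ∀ b → τ i b ∸ 2 * m ≡ sidePt i b
      τ∸2m false = trans (cong (_∸ 2 * m) (*-distribˡ-+ 2 i m)) (m+n∸n≡m (2 * i) (2 * m))
      τ∸2m true  = trans (cong (λ z → suc z ∸ 2 * m) (*-distribˡ-+ 2 i m))
                         (trans (+-∸-assoc 1 (m≤n+m (2 * m) (2 * i))) (cong suc (m+n∸n≡m (2 * i) (2 * m))))

    ⟶τ₁ : ∀ h i b {x y} → y ≡ τ i b → ∂₁.Connected x (h i b) → ∂₁.Connected x (collapse h y)
    ⟶τ₁ h i b refl = subst (∂₁.Connected _) (sym (collapse-τ h i b))

    ⟶τ₂ : ∀ h i b {x y} → y ≡ τ i b → ∂₂.Connected x (h i b) → ∂₂.Connected x (collapse h y)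
    ⟶τ₂ h i b refl = subst (∂₂.Connected _) (sym (collapse-τ h i b))

    ⟶prefix₁ : ∀ h {x y z} → y ≡ z → z < 2 * m → ∂₁.Connected x z → ∂₁.Connected x (collapse h y)
    ⟶prefix₁ h refl z< = subst (∂₁.Connected _) (sym (collapse-prefix h z<))

    ⟶prefix₂ : ∀ h {x y z} → y ≡ z → z < 2 * m → ∂₂.Connected x z → ∂₂.Connected x (collapse h y)
    ⟶prefix₂ h refl z< = subst (∂₂.Connected _) (sym (collapse-prefix h z<))

    τ⟶₁ : ∀ h i b {z} → ∂₁.Connected (h i b) z → ∂₁.Connected (collapse h (τ i b)) z
    τ⟶₁ h i b = subst (λ x → ∂₁.Connected x _) (sym (collapse-τ h i b))

    τ⟶₂ : ∀ h i b {z} → ∂₂.Connected (h i b) z → ∂₂.Connected (collapse h (τ i b)) z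
    τ⟶₂ h i b = subst (λ x → ∂₂.Connected x _) (sym (collapse-τ h i b))

    Classification : (ℕ → Set) → Set
    Classification Dangling =
      ∀ {p} → p < m → (multiplicity t₁ (label u p) ≡ 0 × multiplicity t₂ (label u p) ≡ 0) ⊎ Dangling p

    fresh-classification : All (λ x → multiplicity u (proj₁ x) ≡ 0) t₁ → All (λ x → multiplicity u (proj₁ x) ≡ 0) t₂ →
                           Classification (λ _ → ⊥)
    fresh-classification fresh₁ fresh₂ {p} p<m = inj₁ (absent t₁ fresh₁ , absent t₂ fresh₂)
      where
      absent : ∀ t → All (λ x → multiplicity u (proj₁ x) ≡ 0) t → multiplicity t (label u p) ≡ 0
      absent t fresh = multiplicity-absent t (All.map (λ none → multiplicity≡0⇒≢label u none p<m) fresh)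

    TailSteps₁₂ : (ℕ → Bool → ℕ) → Set
    TailSteps₁₂ h = ∀ {i} b → i < E₁.c →
      ∂₂.Connected (collapse h (τ i b)) (collapse h (arcMatch E₁.k (τ i b))) ×
      ∂₂.Connected (collapse h (τ i b)) (collapse h (edgeMatch E₁.W (τ i b)))

    TailSteps₂₁ : (ℕ → Bool → ℕ) → Set
    TailSteps₂₁ h = ∀ {i} b → i < E₂.c →
      ∂₁.Connected (collapse h (τ i b)) (collapse h (arcMatch E₂.k (τ i b))) ×
      ∂₁.Connected (collapse h (τ i b)) (collapse h (edgeMatch E₂.W (τ i b)))

    simulate₁₂ : ∀ h Dangling → Classification Dangling →
      ∂₂.Connected lastRight (collapse h (arcMatch E₁.k lastRight)) → ∂₂.Connected 0 (collapse h (arcMatch E₁.k 0)) →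
      (∀ {p} b → Dangling p → ∂₂.Connected (sidePt p b) (collapse h (edgeMatch E₁.W (sidePt p b)))) →
      TailSteps₁₂ h → Simulates₁₂ (collapse h)
    simulate₁₂ h = S₁₂.simulate (collapse h) (collapse-prefix h)

    simulate₂₁ : ∀ h Dangling → Classification Dangling →
      ∂₁.Connected lastRight (collapse h (arcMatch E₂.k lastRight)) → ∂₁.Connected 0 (collapse h (arcMatch E₂.k 0)) →
      (∀ {p} b → Dangling p → ∂₁.Connected (sidePt p b) (collapse h (edgeMatch E₂.W (sidePt p b)))) →
      TailSteps₂₁ h → Simulates₂₁ (collapse h)
    simulate₂₁ h Dangling classify = S₂₁.simulate (collapse h) (collapse-prefix h) Dangling (Sum.map₁ swap ∘ classify)

    boundaryComponents-move : ∀ h₁₂ h₂₁ → Simulates₁₂ (collapse h₁₂) → Simulates₂₁ (collapse h₂₁) →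
      boundaryComponents E₁.W + repCount E₂.W (sides m E₂.c) ≡ boundaryComponents E₂.W + repCount E₁.W (sides m E₁.c)
    boundaryComponents-move h₁₂ h₂₁ =
      boundaryComponents-compare (collapse h₁₂) (collapse h₂₁) (collapse-prefix h₁₂) (collapse-prefix h₂₁)

    boundaryComponents-preserved : ∀ h₁₂ h₂₁ → Simulates₁₂ (collapse h₁₂) → Simulates₂₁ (collapse h₂₁) →
      All (λ y → isRep E₁.W E₁.k y ≡ false) (sides m E₁.c) →
      All (λ y → isRep E₂.W E₂.k y ≡ false) (sides m E₂.c) →
      boundaryComponents E₁.W ≡ boundaryComponents E₂.W
    boundaryComponents-preserved h₁₂ h₂₁ sim₁₂ sim₂₁ ¬reps₁ ¬reps₂ = begin
      boundaryComponents E₁.W                                ≡⟨ +-identityʳ _ ⟨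
      boundaryComponents E₁.W + 0                            ≡⟨ cong (boundaryComponents E₁.W +_) (repCount-none E₂.W ¬reps₂) ⟨
      boundaryComponents E₁.W + repCount E₂.W (sides m E₂.c) ≡⟨ boundaryComponents-move h₁₂ h₂₁ sim₁₂ sim₂₁ ⟩
      boundaryComponents E₂.W + repCount E₁.W (sides m E₁.c) ≡⟨ cong (boundaryComponents E₂.W +_) (repCount-none E₁.W ¬reps₁) ⟩
      boundaryComponents E₂.W + 0                            ≡⟨ +-identityʳ _ ⟩
      boundaryComponents E₂.W                                ∎
      where open ≡-Reasoning

pattern L = false
pattern R = true

lit : ∀ {m n} → T (m <ᵇ n) → m < n
lit = <ᵇ⇒< _ _

module TwistedLoop (a : ℕ × Bool) (u′ : SignedRotation) (e : ℕ)
  (wf₁ : WellFormed (a ∷ u′ ++ (e , true) ∷ (e , false) ∷ [])) (wf₂ : WellFormed (a ∷ u′ ++ []))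
  (fresh : multiplicity (a ∷ u′) e ≡ 0) where

  open Prefix a u′
  open Move ((e , true) ∷ (e , false) ∷ []) [] wf₁ wf₂

  enter : arcMatch E₁.k lastRight ≡ τ 0 L
  enter = E₁.arc-enter-tail (lit tt)
  leave : arcMatch E₁.k (τ 0 L) ≡ lastRight
  leave = E₁.arc-leave-tail (lit tt)
  across : arcMatch E₁.k (τ 0 R) ≡ τ 1 L
  across = E₁.arc-tail-right 0 (lit tt)
  across′ : arcMatch E₁.k (τ 1 L) ≡ τ 0 R
  across′ = E₁.arc-tail-left 0 (lit tt)
  wrap : arcMatch E₁.k (τ 1 R) ≡ 0
  wrap = E₁.arc-tail-last 1 refl
  wrap′ : arcMatch E₁.k 0 ≡ τ 1 R
  wrap′ = E₁.arc-first-tail 1 refl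
  loop : ∀ b → edgeMatch E₁.W (τ 0 b) ≡ τ 1 b
  loop b = Edges₁.edge-tail-tail 0 1 b (lit tt) (lit tt) (λ ()) refl
  loop′ : ∀ b → edgeMatch E₁.W (τ 1 b) ≡ τ 0 b
  loop′ b = Edges₁.edge-tail-tail 1 0 b (lit tt) (lit tt) (λ ()) refl
  close : arcMatch E₂.k lastRight ≡ 0
  close = E₂.arc-lastRight-first refl
  close′ : arcMatch E₂.k 0 ≡ lastRight
  close′ = E₂.arc-first-lastRight refl

  classify : Classification (λ _ → ⊥)
  classify = fresh-classification (fresh ∷ fresh ∷ []) []

  toLastRight : ℕ → Bool → ℕ
  toLastRight _ _ = lastRight

  toFirst : ℕ → Bool → ℕ
  toFirst _ _ = 0

  lastRight⟶0 : ∂₁.Connected lastRight 0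
  lastRight⟶0 =
    lastRight ∂₁.α⟨ enter ⟩ τ 0 L ∂₁.β⟨ loop L ⟩ τ 1 L ∂₁.α⟨ across′ ⟩ τ 0 R ∂₁.β⟨ loop R ⟩ τ 1 R ∂₁.α⟨ wrap ⟩ 0 ∂₁.■

  sim₁₂ : Simulates₁₂ (collapse toLastRight)
  sim₁₂ = simulate₁₂ h (λ _ → ⊥) classify
    (⟶τ₂ h 0 L enter ε) (⟶τ₂ h 1 R wrap′ (0 ∂₂.α⟨ close′ ⟩ lastRight ∂₂.■)) (λ _ ()) tail
    where
    h = toLastRight
    tail : TailSteps₁₂ h
    tail {0} L _ = τ⟶₂ h 0 L (⟶prefix₂ h leave lastRight<2m ε) , τ⟶₂ h 0 L (⟶τ₂ h 1 L (loop L) ε)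
    tail {0} R _ = τ⟶₂ h 0 R (⟶τ₂ h 1 L across ε) , τ⟶₂ h 0 R (⟶τ₂ h 1 R (loop R) ε)
    tail {1} L _ = τ⟶₂ h 1 L (⟶τ₂ h 0 R across′ ε) , τ⟶₂ h 1 L (⟶τ₂ h 0 L (loop′ L) ε)
    tail {1} R _ = τ⟶₂ h 1 R (⟶prefix₂ h wrap 0<2m (lastRight ∂₂.α⟨ close ⟩ 0 ∂₂.■)) , τ⟶₂ h 1 R (⟶τ₂ h 0 R (loop′ R) ε)
    tail {suc (suc _)} _ (s≤s (s≤s ()))

  sim₂₁ : Simulates₂₁ (collapse toFirst)
  sim₂₁ = simulate₂₁ h (λ _ → ⊥) classify
    (⟶prefix₁ h close 0<2m lastRight⟶0)
    (⟶prefix₁ h close′ lastRight<2m (∂₁.Connected-sym (prefix<₁ lastRight<2m) lastRight⟶0))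
    (λ _ ()) (λ _ ())
    where h = toFirst

  tail-reps : All (λ x → isRep E₁.W E₁.k x ≡ false) (sides m 2)
  tail-reps = τ-joins₁ 0 L (lit tt) lastRight<2m (τ 0 L ∂₁.α⟨ leave ⟩ lastRight ∂₁.■)
            ∷ τ-joins₁ 0 R (lit tt) lastRight<2m (τ 0 R ∂₁.α⟨ across ⟩ τ 1 L ∂₁.β⟨ loop′ L ⟩ τ 0 L ∂₁.α⟨ leave ⟩ lastRight ∂₁.■)
            ∷ τ-joins₁ 1 L (lit tt) lastRight<2m (τ 1 L ∂₁.β⟨ loop′ L ⟩ τ 0 L ∂₁.α⟨ leave ⟩ lastRight ∂₁.■)
            ∷ τ-joins₁ 1 R (lit tt) 0<2m (τ 1 R ∂₁.α⟨ wrap ⟩ 0 ∂₁.■)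
            ∷ []

  boundaryComponents-≡ : boundaryComponents E₁.W ≡ boundaryComponents E₂.W
  boundaryComponents-≡ = boundaryComponents-preserved toLastRight toFirst sim₁₂ sim₂₁ tail-reps []

module TwistedLoopOverChord (a : ℕ × Bool) (u′ : SignedRotation) (e x px : ℕ)
  (wf₁ : WellFormed (a ∷ u′ ++ (e , true) ∷ (x , true) ∷ (e , false) ∷ []))
  (wf₂ : WellFormed (a ∷ u′ ++ (x , false) ∷ []))
  (fresh : multiplicity (a ∷ u′) e ≡ 0) (once : multiplicity (a ∷ u′) x ≡ 1)
  (px<m : px < length (a ∷ u′)) (px-label : label (a ∷ u′) px ≡ x) (px-sign : sign (a ∷ u′) px ≡ true) where

  open Prefix a u′
  open Move ((e , true) ∷ (x , true) ∷ (e , false) ∷ []) ((x , false) ∷ []) wf₁ wf₂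

  P : Bool → ℕ
  P b = sidePt px b

  P<2m : ∀ b → P b < 2 * m
  P<2m b = sidePt< b px<m

  enter : arcMatch E₁.k lastRight ≡ τ 0 L
  enter = E₁.arc-enter-tail (lit tt)
  leave : arcMatch E₁.k (τ 0 L) ≡ lastRight
  leave = E₁.arc-leave-tail (lit tt)
  across₀ : arcMatch E₁.k (τ 0 R) ≡ τ 1 L
  across₀ = E₁.arc-tail-right 0 (lit tt)
  across₀′ : arcMatch E₁.k (τ 1 L) ≡ τ 0 R
  across₀′ = E₁.arc-tail-left 0 (lit tt)
  across₁ : arcMatch E₁.k (τ 1 R) ≡ τ 2 L
  across₁ = E₁.arc-tail-right 1 (lit tt)
  across₁′ : arcMatch E₁.k (τ 2 L) ≡ τ 1 R
  across₁′ = E₁.arc-tail-left 1 (lit tt)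
  wrap : arcMatch E₁.k (τ 2 R) ≡ 0
  wrap = E₁.arc-tail-last 2 refl
  wrap′ : arcMatch E₁.k 0 ≡ τ 2 R
  wrap′ = E₁.arc-first-tail 2 refl
  loop : ∀ b → edgeMatch E₁.W (τ 0 b) ≡ τ 2 b
  loop b = Edges₁.edge-tail-tail 0 2 b (lit tt) (lit tt) (λ ()) refl
  loop′ : ∀ b → edgeMatch E₁.W (τ 2 b) ≡ τ 0 b
  loop′ b = Edges₁.edge-tail-tail 2 0 b (lit tt) (lit tt) (λ ()) refl
  chord : ∀ b → edgeMatch E₁.W (τ 1 b) ≡ P (not b)
  chord b = Edges₁.edge-tail-prefix 1 px b (lit tt) px<m px-label px-sign
  chord′ : ∀ b → edgeMatch E₁.W (P b) ≡ τ 1 (not b)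
  chord′ b = Edges₁.edge-prefix-tail px 1 b px<m (lit tt) (sym px-label) px-sign

  enter₂ : arcMatch E₂.k lastRight ≡ τ 0 L
  enter₂ = E₂.arc-enter-tail (lit tt)
  leave₂ : arcMatch E₂.k (τ 0 L) ≡ lastRight
  leave₂ = E₂.arc-leave-tail (lit tt)
  wrap₂ : arcMatch E₂.k (τ 0 R) ≡ 0
  wrap₂ = E₂.arc-tail-last 0 refl
  wrap₂′ : arcMatch E₂.k 0 ≡ τ 0 R
  wrap₂′ = E₂.arc-first-tail 0 refl
  chord₂ : ∀ b → edgeMatch E₂.W (τ 0 b) ≡ P b
  chord₂ b = Edges₂.edge-tail-prefix 0 px b (lit tt) px<m px-label px-sign
  chord₂′ : ∀ b → edgeMatch E₂.W (P b) ≡ τ 0 b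
  chord₂′ b = Edges₂.edge-prefix-tail px 0 b px<m (lit tt) (sym px-label) px-sign

  classify : Classification (_≡ px)
  classify {p} p<m with label u p ≟ x
  ... | yes lp≡x = inj₂ (multiplicity≡1⇒unique u once (p<m , lp≡x) (px<m , px-label))
  ... | no  lp≢x = inj₁ (multiplicity-absent ((e , true) ∷ (x , true) ∷ (e , false) ∷ []) (e≢ ∷ x≢ ∷ e≢ ∷ []) ,
                         multiplicity-absent ((x , false) ∷ []) (x≢ ∷ []))
    where
    e≢ = multiplicity≡0⇒≢label u fresh p<m
    x≢ = lp≢x ∘ sym

  h₁₂ : ℕ → Bool → ℕ
  h₁₂ 1 b = τ 0 (not b)
  h₁₂ _ b = τ 0 b

  h₂₁ : ℕ → Bool → ℕ
  h₂₁ _ L = τ 0 L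
  h₂₁ _ R = τ 2 R

  sim₁₂ : Simulates₁₂ (collapse h₁₂)
  sim₁₂ = simulate₁₂ h (_≡ px) classify
    (⟶τ₂ h 0 L enter (lastRight ∂₂.α⟨ enter₂ ⟩ τ 0 L ∂₂.■))
    (⟶τ₂ h 2 R wrap′ (0 ∂₂.α⟨ wrap₂′ ⟩ τ 0 R ∂₂.■))
    dangling tail
    where
    h = h₁₂
    dangling : ∀ {p} b → p ≡ px → ∂₂.Connected (sidePt p b) (collapse h (edgeMatch E₁.W (sidePt p b)))
    dangling L refl = ⟶τ₂ h 1 R (chord′ L) (P L ∂₂.β⟨ chord₂′ L ⟩ τ 0 L ∂₂.■)
    dangling R refl = ⟶τ₂ h 1 L (chord′ R) (P R ∂₂.β⟨ chord₂′ R ⟩ τ 0 R ∂₂.■)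
    tail : TailSteps₁₂ h
    tail {0} L _ = τ⟶₂ h 0 L (⟶prefix₂ h leave lastRight<2m (τ 0 L ∂₂.α⟨ leave₂ ⟩ lastRight ∂₂.■)) ,
                   τ⟶₂ h 0 L (⟶τ₂ h 2 L (loop L) ε)
    tail {0} R _ = τ⟶₂ h 0 R (⟶τ₂ h 1 L across₀ ε) , τ⟶₂ h 0 R (⟶τ₂ h 2 R (loop R) ε)
    tail {1} L _ = τ⟶₂ h 1 L (⟶τ₂ h 0 R across₀′ ε) ,
                   τ⟶₂ h 1 L (⟶prefix₂ h (chord L) (P<2m R) (τ 0 R ∂₂.β⟨ chord₂ R ⟩ P R ∂₂.■))
    tail {1} R _ = τ⟶₂ h 1 R (⟶τ₂ h 2 L across₁ ε) ,
                   τ⟶₂ h 1 R (⟶prefix₂ h (chord R) (P<2m L) (τ 0 L ∂₂.β⟨ chord₂ L ⟩ P L ∂₂.■))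
    tail {2} L _ = τ⟶₂ h 2 L (⟶τ₂ h 1 R across₁′ ε) , τ⟶₂ h 2 L (⟶τ₂ h 0 L (loop′ L) ε)
    tail {2} R _ = τ⟶₂ h 2 R (⟶prefix₂ h wrap 0<2m (τ 0 R ∂₂.α⟨ wrap₂ ⟩ 0 ∂₂.■)) , τ⟶₂ h 2 R (⟶τ₂ h 0 R (loop′ R) ε)
    tail {suc (suc (suc _))} _ (s≤s (s≤s (s≤s ())))

  sim₂₁ : Simulates₂₁ (collapse h₂₁)
  sim₂₁ = simulate₂₁ h (_≡ px) classify
    (⟶τ₁ h 0 L enter₂ (lastRight ∂₁.α⟨ enter ⟩ τ 0 L ∂₁.■))
    (⟶τ₁ h 0 R wrap₂′ (0 ∂₁.α⟨ wrap′ ⟩ τ 2 R ∂₁.■))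
    dangling tail
    where
    h = h₂₁
    dangling : ∀ {p} b → p ≡ px → ∂₁.Connected (sidePt p b) (collapse h (edgeMatch E₂.W (sidePt p b)))
    dangling L refl = ⟶τ₁ h 0 L (chord₂′ L) (P L ∂₁.β⟨ chord′ L ⟩ τ 1 R ∂₁.α⟨ across₁ ⟩ τ 2 L ∂₁.β⟨ loop′ L ⟩ τ 0 L ∂₁.■)
    dangling R refl = ⟶τ₁ h 0 R (chord₂′ R) (P R ∂₁.β⟨ chord′ R ⟩ τ 1 L ∂₁.α⟨ across₀′ ⟩ τ 0 R ∂₁.β⟨ loop R ⟩ τ 2 R ∂₁.■)
    tail : TailSteps₂₁ h
    tail {0} L _ = τ⟶₁ h 0 L (⟶prefix₁ h leave₂ lastRight<2m (τ 0 L ∂₁.α⟨ leave ⟩ lastRight ∂₁.■)) ,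
                   τ⟶₁ h 0 L (⟶prefix₁ h (chord₂ L) (P<2m L)
                     (τ 0 L ∂₁.β⟨ loop L ⟩ τ 2 L ∂₁.α⟨ across₁′ ⟩ τ 1 R ∂₁.β⟨ chord R ⟩ P L ∂₁.■))
    tail {0} R _ = τ⟶₁ h 0 R (⟶prefix₁ h wrap₂ 0<2m (τ 2 R ∂₁.α⟨ wrap ⟩ 0 ∂₁.■)) ,
                   τ⟶₁ h 0 R (⟶prefix₁ h (chord₂ R) (P<2m R)
                     (τ 2 R ∂₁.β⟨ loop′ R ⟩ τ 0 R ∂₁.α⟨ across₀ ⟩ τ 1 L ∂₁.β⟨ chord L ⟩ P R ∂₁.■))
    tail {suc _} _ (s≤s ())

  tail-reps₁ : All (λ y → isRep E₁.W E₁.k y ≡ false) (sides m 3)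
  tail-reps₁ = τ-joins₁ 0 L (lit tt) lastRight<2m (τ 0 L ∂₁.α⟨ leave ⟩ lastRight ∂₁.■)
             ∷ τ-joins₁ 0 R (lit tt) (P<2m R) (τ 0 R ∂₁.α⟨ across₀ ⟩ τ 1 L ∂₁.β⟨ chord L ⟩ P R ∂₁.■)
             ∷ τ-joins₁ 1 L (lit tt) (P<2m R) (τ 1 L ∂₁.β⟨ chord L ⟩ P R ∂₁.■)
             ∷ τ-joins₁ 1 R (lit tt) (P<2m L) (τ 1 R ∂₁.β⟨ chord R ⟩ P L ∂₁.■)
             ∷ τ-joins₁ 2 L (lit tt) lastRight<2m (τ 2 L ∂₁.β⟨ loop′ L ⟩ τ 0 L ∂₁.α⟨ leave ⟩ lastRight ∂₁.■)
             ∷ τ-joins₁ 2 R (lit tt) 0<2m (τ 2 R ∂₁.α⟨ wrap ⟩ 0 ∂₁.■)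
             ∷ []

  tail-reps₂ : All (λ y → isRep E₂.W E₂.k y ≡ false) (sides m 1)
  tail-reps₂ = τ-joins₂ 0 L (lit tt) lastRight<2m (τ 0 L ∂₂.α⟨ leave₂ ⟩ lastRight ∂₂.■)
             ∷ τ-joins₂ 0 R (lit tt) 0<2m (τ 0 R ∂₂.α⟨ wrap₂ ⟩ 0 ∂₂.■)
             ∷ []

  boundaryComponents-≡ : boundaryComponents E₁.W ≡ boundaryComponents E₂.W
  boundaryComponents-≡ = boundaryComponents-preserved h₁₂ h₂₁ sim₁₂ sim₂₁ tail-reps₁ tail-reps₂

module UntwistedLoop (a : ℕ × Bool) (u′ : SignedRotation) (e : ℕ)
  (wf₁ : WellFormed (a ∷ u′ ++ (e , true) ∷ (e , true) ∷ [])) (wf₂ : WellFormed (a ∷ u′ ++ []))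
  (fresh : multiplicity (a ∷ u′) e ≡ 0) where

  open Prefix a u′
  open Move ((e , true) ∷ (e , true) ∷ []) [] wf₁ wf₂

  enter : arcMatch E₁.k lastRight ≡ τ 0 L
  enter = E₁.arc-enter-tail (lit tt)
  leave : arcMatch E₁.k (τ 0 L) ≡ lastRight
  leave = E₁.arc-leave-tail (lit tt)
  across : arcMatch E₁.k (τ 0 R) ≡ τ 1 L
  across = E₁.arc-tail-right 0 (lit tt)
  across′ : arcMatch E₁.k (τ 1 L) ≡ τ 0 R
  across′ = E₁.arc-tail-left 0 (lit tt)
  wrap : arcMatch E₁.k (τ 1 R) ≡ 0
  wrap = E₁.arc-tail-last 1 refl
  wrap′ : arcMatch E₁.k 0 ≡ τ 1 R
  wrap′ = E₁.arc-first-tail 1 refl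
  loop : ∀ b → edgeMatch E₁.W (τ 0 b) ≡ τ 1 (not b)
  loop b = Edges₁.edge-tail-tail 0 1 b (lit tt) (lit tt) (λ ()) refl
  loop′ : ∀ b → edgeMatch E₁.W (τ 1 b) ≡ τ 0 (not b)
  loop′ b = Edges₁.edge-tail-tail 1 0 b (lit tt) (lit tt) (λ ()) refl
  close : arcMatch E₂.k lastRight ≡ 0
  close = E₂.arc-lastRight-first refl
  close′ : arcMatch E₂.k 0 ≡ lastRight
  close′ = E₂.arc-first-lastRight refl

  classify : Classification (λ _ → ⊥)
  classify = fresh-classification (fresh ∷ fresh ∷ []) []

  toLastRight : ℕ → Bool → ℕ
  toLastRight _ _ = lastRight

  toFirst : ℕ → Bool → ℕ
  toFirst _ _ = 0

  lastRight⟶0 : ∂₁.Connected lastRight 0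
  lastRight⟶0 = lastRight ∂₁.α⟨ enter ⟩ τ 0 L ∂₁.β⟨ loop L ⟩ τ 1 R ∂₁.α⟨ wrap ⟩ 0 ∂₁.■

  sim₁₂ : Simulates₁₂ (collapse toLastRight)
  sim₁₂ = simulate₁₂ h (λ _ → ⊥) classify
    (⟶τ₂ h 0 L enter ε) (⟶τ₂ h 1 R wrap′ (0 ∂₂.α⟨ close′ ⟩ lastRight ∂₂.■)) (λ _ ()) tail
    where
    h = toLastRight
    tail : TailSteps₁₂ h
    tail {0} L _ = τ⟶₂ h 0 L (⟶prefix₂ h leave lastRight<2m ε) , τ⟶₂ h 0 L (⟶τ₂ h 1 R (loop L) ε)
    tail {0} R _ = τ⟶₂ h 0 R (⟶τ₂ h 1 L across ε) , τ⟶₂ h 0 R (⟶τ₂ h 1 L (loop R) ε)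
    tail {1} L _ = τ⟶₂ h 1 L (⟶τ₂ h 0 R across′ ε) , τ⟶₂ h 1 L (⟶τ₂ h 0 R (loop′ L) ε)
    tail {1} R _ = τ⟶₂ h 1 R (⟶prefix₂ h wrap 0<2m (lastRight ∂₂.α⟨ close ⟩ 0 ∂₂.■)) , τ⟶₂ h 1 R (⟶τ₂ h 0 L (loop′ R) ε)
    tail {suc (suc _)} _ (s≤s (s≤s ()))

  sim₂₁ : Simulates₂₁ (collapse toFirst)
  sim₂₁ = simulate₂₁ h (λ _ → ⊥) classify
    (⟶prefix₁ h close 0<2m lastRight⟶0)
    (⟶prefix₁ h close′ lastRight<2m (∂₁.Connected-sym (prefix<₁ lastRight<2m) lastRight⟶0))
    (λ _ ()) (λ _ ())
    where h = toFirst

  τ0R<τ1L : τ 0 R < τ 1 L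
  τ0R<τ1L = ≤-reflexive (sym (*-suc 2 m))

  -- The sides τ 0 R and τ 1 L form a boundary component of their own.
  isolated-isRep : isRep E₁.W E₁.k (τ 0 R) ≡ true
  isolated-isRep = ∂₁.minimal⇒isRep (λ c → minimal (∂₁.Connected-closed Isolated closed (inj₁ refl) c))
    where
    Isolated : ℕ → Set
    Isolated z = z ≡ τ 0 R ⊎ z ≡ τ 1 L
    closed : ∀ {y z} → Isolated y → ∂₁.Step y z → Isolated z
    closed (inj₁ refl) (inj₁ refl) = inj₂ across
    closed (inj₁ refl) (inj₂ refl) = inj₂ (loop R)
    closed (inj₂ refl) (inj₁ refl) = inj₁ across′
    closed (inj₂ refl) (inj₂ refl) = inj₁ (loop′ L)
    minimal : ∀ {z} → Isolated z → τ 0 R ≤ z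
    minimal (inj₁ refl) = ≤-refl
    minimal (inj₂ refl) = <⇒≤ τ0R<τ1L

  tail-reps : repCount E₁.W (sides m 2) ≡ 1
  tail-reps = cong countTrue (cong₂ _∷_ τ0L-joins (cong₂ _∷_ isolated-isRep (cong₂ _∷_ τ1L-joins (cong₂ _∷_ τ1R-joins refl))))
    where
    τ0L-joins : isRep E₁.W E₁.k (τ 0 L) ≡ false
    τ0L-joins = τ-joins₁ 0 L (lit tt) lastRight<2m (τ 0 L ∂₁.α⟨ leave ⟩ lastRight ∂₁.■)
    τ1L-joins : isRep E₁.W E₁.k (τ 1 L) ≡ false
    τ1L-joins = ∂₁.smaller⇒¬isRep (sidePt< L (E₁.tail< {1} (lit tt))) (τ 1 L ∂₁.β⟨ loop′ L ⟩ τ 0 R ∂₁.■) τ0R<τ1L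
    τ1R-joins : isRep E₁.W E₁.k (τ 1 R) ≡ false
    τ1R-joins = τ-joins₁ 1 R (lit tt) 0<2m (τ 1 R ∂₁.α⟨ wrap ⟩ 0 ∂₁.■)

  boundaryComponents-≡+1 : boundaryComponents E₁.W ≡ boundaryComponents E₂.W + 1
  boundaryComponents-≡+1 = begin
    boundaryComponents E₁.W                               ≡⟨ +-identityʳ _ ⟨
    boundaryComponents E₁.W + 0                           ≡⟨ boundaryComponents-move toLastRight toFirst sim₁₂ sim₂₁ ⟩
    boundaryComponents E₂.W + repCount E₁.W (sides m 2)   ≡⟨ cong (boundaryComponents E₂.W +_) tail-reps ⟩
    boundaryComponents E₂.W + 1                           ∎
    where open ≡-Reasoning

module Handle (a : ℕ × Bool) (u′ : SignedRotation) (x e : ℕ)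
  (wf₁ : WellFormed (a ∷ u′ ++ (x , true) ∷ (e , true) ∷ (x , true) ∷ (e , true) ∷ [])) (wf₂ : WellFormed (a ∷ u′ ++ []))
  (fresh-x : multiplicity (a ∷ u′) x ≡ 0) (fresh-e : multiplicity (a ∷ u′) e ≡ 0) where

  open Prefix a u′
  open Move ((x , true) ∷ (e , true) ∷ (x , true) ∷ (e , true) ∷ []) [] wf₁ wf₂

  enter : arcMatch E₁.k lastRight ≡ τ 0 L
  enter = E₁.arc-enter-tail (lit tt)
  leave : arcMatch E₁.k (τ 0 L) ≡ lastRight
  leave = E₁.arc-leave-tail (lit tt)
  across : ∀ i → suc i < 4 → arcMatch E₁.k (τ i R) ≡ τ (suc i) L
  across = E₁.arc-tail-right
  across′ : ∀ i → suc i < 4 → arcMatch E₁.k (τ (suc i) L) ≡ τ i R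
  across′ = E₁.arc-tail-left
  wrap : arcMatch E₁.k (τ 3 R) ≡ 0
  wrap = E₁.arc-tail-last 3 refl
  wrap′ : arcMatch E₁.k 0 ≡ τ 3 R
  wrap′ = E₁.arc-first-tail 3 refl
  x-chord : ∀ b → edgeMatch E₁.W (τ 0 b) ≡ τ 2 (not b)
  x-chord b = Edges₁.edge-tail-tail 0 2 b (lit tt) (lit tt) (λ ()) refl
  x-chord′ : ∀ b → edgeMatch E₁.W (τ 2 b) ≡ τ 0 (not b)
  x-chord′ b = Edges₁.edge-tail-tail 2 0 b (lit tt) (lit tt) (λ ()) refl
  e-chord : ∀ b → edgeMatch E₁.W (τ 1 b) ≡ τ 3 (not b)
  e-chord b = Edges₁.edge-tail-tail 1 3 b (lit tt) (lit tt) (λ ()) refl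
  e-chord′ : ∀ b → edgeMatch E₁.W (τ 3 b) ≡ τ 1 (not b)
  e-chord′ b = Edges₁.edge-tail-tail 3 1 b (lit tt) (lit tt) (λ ()) refl
  close : arcMatch E₂.k lastRight ≡ 0
  close = E₂.arc-lastRight-first refl
  close′ : arcMatch E₂.k 0 ≡ lastRight
  close′ = E₂.arc-first-lastRight refl

  classify : Classification (λ _ → ⊥)
  classify = fresh-classification (fresh-x ∷ fresh-e ∷ fresh-x ∷ fresh-e ∷ []) []

  toLastRight : ℕ → Bool → ℕ
  toLastRight _ _ = lastRight

  toFirst : ℕ → Bool → ℕ
  toFirst _ _ = 0

  lastRight⟶0 : ∂₁.Connected lastRight 0
  lastRight⟶0 = lastRight ∂₁.α⟨ enter ⟩ τ 0 L ∂₁.β⟨ x-chord L ⟩ τ 2 R ∂₁.α⟨ across 2 (lit tt) ⟩ τ 3 L ∂₁.β⟨ e-chord′ L ⟩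
                τ 1 R ∂₁.α⟨ across 1 (lit tt) ⟩ τ 2 L ∂₁.β⟨ x-chord′ L ⟩ τ 0 R ∂₁.α⟨ across 0 (lit tt) ⟩ τ 1 L ∂₁.β⟨ e-chord L ⟩
                τ 3 R ∂₁.α⟨ wrap ⟩ 0 ∂₁.■

  sim₁₂ : Simulates₁₂ (collapse toLastRight)
  sim₁₂ = simulate₁₂ h (λ _ → ⊥) classify
    (⟶τ₂ h 0 L enter ε) (⟶τ₂ h 3 R wrap′ (0 ∂₂.α⟨ close′ ⟩ lastRight ∂₂.■)) (λ _ ()) tail
    where
    h = toLastRight
    tail : TailSteps₁₂ h
    tail {0} L _ = τ⟶₂ h 0 L (⟶prefix₂ h leave lastRight<2m ε) , τ⟶₂ h 0 L (⟶τ₂ h 2 R (x-chord L) ε)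
    tail {0} R _ = τ⟶₂ h 0 R (⟶τ₂ h 1 L (across 0 (lit tt)) ε) , τ⟶₂ h 0 R (⟶τ₂ h 2 L (x-chord R) ε)
    tail {1} L _ = τ⟶₂ h 1 L (⟶τ₂ h 0 R (across′ 0 (lit tt)) ε) , τ⟶₂ h 1 L (⟶τ₂ h 3 R (e-chord L) ε)
    tail {1} R _ = τ⟶₂ h 1 R (⟶τ₂ h 2 L (across 1 (lit tt)) ε) , τ⟶₂ h 1 R (⟶τ₂ h 3 L (e-chord R) ε)
    tail {2} L _ = τ⟶₂ h 2 L (⟶τ₂ h 1 R (across′ 1 (lit tt)) ε) , τ⟶₂ h 2 L (⟶τ₂ h 0 R (x-chord′ L) ε)
    tail {2} R _ = τ⟶₂ h 2 R (⟶τ₂ h 3 L (across 2 (lit tt)) ε) , τ⟶₂ h 2 R (⟶τ₂ h 0 L (x-chord′ R) ε)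
    tail {3} L _ = τ⟶₂ h 3 L (⟶τ₂ h 2 R (across′ 2 (lit tt)) ε) , τ⟶₂ h 3 L (⟶τ₂ h 1 R (e-chord′ L) ε)
    tail {3} R _ = τ⟶₂ h 3 R (⟶prefix₂ h wrap 0<2m (lastRight ∂₂.α⟨ close ⟩ 0 ∂₂.■)) ,
                   τ⟶₂ h 3 R (⟶τ₂ h 1 L (e-chord′ R) ε)
    tail {suc (suc (suc (suc _)))} _ (s≤s (s≤s (s≤s (s≤s ()))))

  sim₂₁ : Simulates₂₁ (collapse toFirst)
  sim₂₁ = simulate₂₁ h (λ _ → ⊥) classify
    (⟶prefix₁ h close 0<2m lastRight⟶0)
    (⟶prefix₁ h close′ lastRight<2m (∂₁.Connected-sym (prefix<₁ lastRight<2m) lastRight⟶0))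
    (λ _ ()) (λ _ ())
    where h = toFirst

  tail-reps : All (λ y → isRep E₁.W E₁.k y ≡ false) (sides m 4)
  tail-reps =
      τ-joins₁ 0 L (lit tt) lastRight<2m (τ 0 L ∂₁.α⟨ leave ⟩ lastRight ∂₁.■)
    ∷ τ-joins₁ 0 R (lit tt) 0<2m (τ 0 R ∂₁.α⟨ across 0 (lit tt) ⟩ τ 1 L ∂₁.β⟨ e-chord L ⟩ τ 3 R ∂₁.α⟨ wrap ⟩ 0 ∂₁.■)
    ∷ τ-joins₁ 1 L (lit tt) 0<2m (τ 1 L ∂₁.β⟨ e-chord L ⟩ τ 3 R ∂₁.α⟨ wrap ⟩ 0 ∂₁.■)
    ∷ τ-joins₁ 1 R (lit tt) lastRight<2m
        (τ 1 R ∂₁.β⟨ e-chord R ⟩ τ 3 L ∂₁.α⟨ across′ 2 (lit tt) ⟩ τ 2 R ∂₁.β⟨ x-chord′ R ⟩ τ 0 L ∂₁.α⟨ leave ⟩ lastRight ∂₁.■)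
    ∷ τ-joins₁ 2 L (lit tt) 0<2m
        (τ 2 L ∂₁.β⟨ x-chord′ L ⟩ τ 0 R ∂₁.α⟨ across 0 (lit tt) ⟩ τ 1 L ∂₁.β⟨ e-chord L ⟩ τ 3 R ∂₁.α⟨ wrap ⟩ 0 ∂₁.■)
    ∷ τ-joins₁ 2 R (lit tt) lastRight<2m (τ 2 R ∂₁.β⟨ x-chord′ R ⟩ τ 0 L ∂₁.α⟨ leave ⟩ lastRight ∂₁.■)
    ∷ τ-joins₁ 3 L (lit tt) lastRight<2m
        (τ 3 L ∂₁.α⟨ across′ 2 (lit tt) ⟩ τ 2 R ∂₁.β⟨ x-chord′ R ⟩ τ 0 L ∂₁.α⟨ leave ⟩ lastRight ∂₁.■)
    ∷ τ-joins₁ 3 R (lit tt) 0<2m (τ 3 R ∂₁.α⟨ wrap ⟩ 0 ∂₁.■)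
    ∷ []

  boundaryComponents-≡ : boundaryComponents E₁.W ≡ boundaryComponents E₂.W
  boundaryComponents-≡ = boundaryComponents-preserved toLastRight toFirst sim₁₂ sim₂₁ tail-reps []

module HandleOverChord (a : ℕ × Bool) (u′ : SignedRotation) (x y e py : ℕ)
  (wf₁ : WellFormed (a ∷ u′ ++ (x , true) ∷ (y , true) ∷ (e , true) ∷ (x , true) ∷ (e , true) ∷ []))
  (wf₂ : WellFormed (a ∷ u′ ++ (y , true) ∷ []))
  (fresh-x : multiplicity (a ∷ u′) x ≡ 0) (once-y : multiplicity (a ∷ u′) y ≡ 1) (fresh-e : multiplicity (a ∷ u′) e ≡ 0)
  (py<m : py < length (a ∷ u′)) (py-label : label (a ∷ u′) py ≡ y) (py-sign : sign (a ∷ u′) py ≡ true) where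

  open Prefix a u′
  open Move ((x , true) ∷ (y , true) ∷ (e , true) ∷ (x , true) ∷ (e , true) ∷ []) ((y , true) ∷ []) wf₁ wf₂

  P : Bool → ℕ
  P b = sidePt py b

  P<2m : ∀ b → P b < 2 * m
  P<2m b = sidePt< b py<m

  enter : arcMatch E₁.k lastRight ≡ τ 0 L
  enter = E₁.arc-enter-tail (lit tt)
  leave : arcMatch E₁.k (τ 0 L) ≡ lastRight
  leave = E₁.arc-leave-tail (lit tt)
  across : ∀ i → suc i < 5 → arcMatch E₁.k (τ i R) ≡ τ (suc i) L
  across = E₁.arc-tail-right
  across′ : ∀ i → suc i < 5 → arcMatch E₁.k (τ (suc i) L) ≡ τ i R
  across′ = E₁.arc-tail-left
  wrap : arcMatch E₁.k (τ 4 R) ≡ 0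
  wrap = E₁.arc-tail-last 4 refl
  wrap′ : arcMatch E₁.k 0 ≡ τ 4 R
  wrap′ = E₁.arc-first-tail 4 refl
  x-chord : ∀ b → edgeMatch E₁.W (τ 0 b) ≡ τ 3 (not b)
  x-chord b = Edges₁.edge-tail-tail 0 3 b (lit tt) (lit tt) (λ ()) refl
  x-chord′ : ∀ b → edgeMatch E₁.W (τ 3 b) ≡ τ 0 (not b)
  x-chord′ b = Edges₁.edge-tail-tail 3 0 b (lit tt) (lit tt) (λ ()) refl
  e-chord : ∀ b → edgeMatch E₁.W (τ 2 b) ≡ τ 4 (not b)
  e-chord b = Edges₁.edge-tail-tail 2 4 b (lit tt) (lit tt) (λ ()) refl
  e-chord′ : ∀ b → edgeMatch E₁.W (τ 4 b) ≡ τ 2 (not b)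
  e-chord′ b = Edges₁.edge-tail-tail 4 2 b (lit tt) (lit tt) (λ ()) refl
  y-chord : ∀ b → edgeMatch E₁.W (τ 1 b) ≡ P (not b)
  y-chord b = Edges₁.edge-tail-prefix 1 py b (lit tt) py<m py-label py-sign
  y-chord′ : ∀ b → edgeMatch E₁.W (P b) ≡ τ 1 (not b)
  y-chord′ b = Edges₁.edge-prefix-tail py 1 b py<m (lit tt) (sym py-label) py-sign

  enter₂ : arcMatch E₂.k lastRight ≡ τ 0 L
  enter₂ = E₂.arc-enter-tail (lit tt)
  leave₂ : arcMatch E₂.k (τ 0 L) ≡ lastRight
  leave₂ = E₂.arc-leave-tail (lit tt)
  wrap₂ : arcMatch E₂.k (τ 0 R) ≡ 0
  wrap₂ = E₂.arc-tail-last 0 refl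
  wrap₂′ : arcMatch E₂.k 0 ≡ τ 0 R
  wrap₂′ = E₂.arc-first-tail 0 refl
  y-chord₂ : ∀ b → edgeMatch E₂.W (τ 0 b) ≡ P (not b)
  y-chord₂ b = Edges₂.edge-tail-prefix 0 py b (lit tt) py<m py-label py-sign
  y-chord₂′ : ∀ b → edgeMatch E₂.W (P b) ≡ τ 0 (not b)
  y-chord₂′ b = Edges₂.edge-prefix-tail py 0 b py<m (lit tt) (sym py-label) py-sign

  classify : Classification (_≡ py)
  classify {p} p<m with label u p ≟ y
  ... | yes lp≡y = inj₂ (multiplicity≡1⇒unique u once-y (p<m , lp≡y) (py<m , py-label))
  ... | no  lp≢y = inj₁ (multiplicity-absent ((x , true) ∷ (y , true) ∷ (e , true) ∷ (x , true) ∷ (e , true) ∷ [])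
                           (x≢ ∷ y≢ ∷ e≢ ∷ x≢ ∷ e≢ ∷ []) ,
                         multiplicity-absent ((y , true) ∷ []) (y≢ ∷ []))
    where
    x≢ = multiplicity≡0⇒≢label u fresh-x p<m
    e≢ = multiplicity≡0⇒≢label u fresh-e p<m
    y≢ = lp≢y ∘ sym

  h₁₂ : ℕ → Bool → ℕ
  h₁₂ 1 R = τ 0 R
  h₁₂ 2 L = τ 0 R
  h₁₂ 4 R = τ 0 R
  h₁₂ _ _ = τ 0 L

  h₂₁ : ℕ → Bool → ℕ
  h₂₁ _ L = τ 0 L
  h₂₁ _ R = τ 4 R

  sim₁₂ : Simulates₁₂ (collapse h₁₂)
  sim₁₂ = simulate₁₂ h (_≡ py) classify
    (⟶τ₂ h 0 L enter (lastRight ∂₂.α⟨ enter₂ ⟩ τ 0 L ∂₂.■))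
    (⟶τ₂ h 4 R wrap′ (0 ∂₂.α⟨ wrap₂′ ⟩ τ 0 R ∂₂.■))
    dangling tail
    where
    h = h₁₂
    dangling : ∀ {p} b → p ≡ py → ∂₂.Connected (sidePt p b) (collapse h (edgeMatch E₁.W (sidePt p b)))
    dangling L refl = ⟶τ₂ h 1 R (y-chord′ L) (P L ∂₂.β⟨ y-chord₂′ L ⟩ τ 0 R ∂₂.■)
    dangling R refl = ⟶τ₂ h 1 L (y-chord′ R) (P R ∂₂.β⟨ y-chord₂′ R ⟩ τ 0 L ∂₂.■)
    tail : TailSteps₁₂ h
    tail {0} L _ = τ⟶₂ h 0 L (⟶prefix₂ h leave lastRight<2m (τ 0 L ∂₂.α⟨ leave₂ ⟩ lastRight ∂₂.■)) ,
                   τ⟶₂ h 0 L (⟶τ₂ h 3 R (x-chord L) ε)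
    tail {0} R _ = τ⟶₂ h 0 R (⟶τ₂ h 1 L (across 0 (lit tt)) ε) , τ⟶₂ h 0 R (⟶τ₂ h 3 L (x-chord R) ε)
    tail {1} L _ = τ⟶₂ h 1 L (⟶τ₂ h 0 R (across′ 0 (lit tt)) ε) ,
                   τ⟶₂ h 1 L (⟶prefix₂ h (y-chord L) (P<2m R) (τ 0 L ∂₂.β⟨ y-chord₂ L ⟩ P R ∂₂.■))
    tail {1} R _ = τ⟶₂ h 1 R (⟶τ₂ h 2 L (across 1 (lit tt)) ε) ,
                   τ⟶₂ h 1 R (⟶prefix₂ h (y-chord R) (P<2m L) (τ 0 R ∂₂.β⟨ y-chord₂ R ⟩ P L ∂₂.■))
    tail {2} L _ = τ⟶₂ h 2 L (⟶τ₂ h 1 R (across′ 1 (lit tt)) ε) , τ⟶₂ h 2 L (⟶τ₂ h 4 R (e-chord L) ε)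
    tail {2} R _ = τ⟶₂ h 2 R (⟶τ₂ h 3 L (across 2 (lit tt)) ε) , τ⟶₂ h 2 R (⟶τ₂ h 4 L (e-chord R) ε)
    tail {3} L _ = τ⟶₂ h 3 L (⟶τ₂ h 2 R (across′ 2 (lit tt)) ε) , τ⟶₂ h 3 L (⟶τ₂ h 0 R (x-chord′ L) ε)
    tail {3} R _ = τ⟶₂ h 3 R (⟶τ₂ h 4 L (across 3 (lit tt)) ε) , τ⟶₂ h 3 R (⟶τ₂ h 0 L (x-chord′ R) ε)
    tail {4} L _ = τ⟶₂ h 4 L (⟶τ₂ h 3 R (across′ 3 (lit tt)) ε) , τ⟶₂ h 4 L (⟶τ₂ h 2 R (e-chord′ L) ε)
    tail {4} R _ = τ⟶₂ h 4 R (⟶prefix₂ h wrap 0<2m (τ 0 R ∂₂.α⟨ wrap₂ ⟩ 0 ∂₂.■)) , τ⟶₂ h 4 R (⟶τ₂ h 2 L (e-chord′ R) ε)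
    tail {suc (suc (suc (suc (suc _))))} _ (s≤s (s≤s (s≤s (s≤s (s≤s ())))))

  τ0L⟶PR : ∂₁.Connected (τ 0 L) (P R)
  τ0L⟶PR = τ 0 L ∂₁.β⟨ x-chord L ⟩ τ 3 R ∂₁.α⟨ across 3 (lit tt) ⟩ τ 4 L ∂₁.β⟨ e-chord′ L ⟩ τ 2 R ∂₁.α⟨ across 2 (lit tt) ⟩
           τ 3 L ∂₁.β⟨ x-chord′ L ⟩ τ 0 R ∂₁.α⟨ across 0 (lit tt) ⟩ τ 1 L ∂₁.β⟨ y-chord L ⟩ P R ∂₁.■

  τ4R⟶PL : ∂₁.Connected (τ 4 R) (P L)
  τ4R⟶PL = τ 4 R ∂₁.β⟨ e-chord′ R ⟩ τ 2 L ∂₁.α⟨ across′ 1 (lit tt) ⟩ τ 1 R ∂₁.β⟨ y-chord R ⟩ P L ∂₁.■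

  sim₂₁ : Simulates₂₁ (collapse h₂₁)
  sim₂₁ = simulate₂₁ h (_≡ py) classify
    (⟶τ₁ h 0 L enter₂ (lastRight ∂₁.α⟨ enter ⟩ τ 0 L ∂₁.■))
    (⟶τ₁ h 0 R wrap₂′ (0 ∂₁.α⟨ wrap′ ⟩ τ 4 R ∂₁.■))
    dangling tail
    where
    h = h₂₁
    dangling : ∀ {p} b → p ≡ py → ∂₁.Connected (sidePt p b) (collapse h (edgeMatch E₂.W (sidePt p b)))
    dangling L refl = ⟶τ₁ h 0 R (y-chord₂′ L) (∂₁.Connected-sym (sidePt< R (E₁.tail< {4} (lit tt))) τ4R⟶PL)
    dangling R refl = ⟶τ₁ h 0 L (y-chord₂′ R) (∂₁.Connected-sym (sidePt< L (E₁.tail< {0} (lit tt))) τ0L⟶PR)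
    tail : TailSteps₂₁ h
    tail {0} L _ = τ⟶₁ h 0 L (⟶prefix₁ h leave₂ lastRight<2m (τ 0 L ∂₁.α⟨ leave ⟩ lastRight ∂₁.■)) ,
                   τ⟶₁ h 0 L (⟶prefix₁ h (y-chord₂ L) (P<2m R) τ0L⟶PR)
    tail {0} R _ = τ⟶₁ h 0 R (⟶prefix₁ h wrap₂ 0<2m (τ 4 R ∂₁.α⟨ wrap ⟩ 0 ∂₁.■)) ,
                   τ⟶₁ h 0 R (⟶prefix₁ h (y-chord₂ R) (P<2m L) τ4R⟶PL)
    tail {suc _} _ (s≤s ())

  tail-reps₁ : All (λ z → isRep E₁.W E₁.k z ≡ false) (sides m 5)
  tail-reps₁ =
      τ-joins₁ 0 L (lit tt) lastRight<2m (τ 0 L ∂₁.α⟨ leave ⟩ lastRight ∂₁.■)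
    ∷ τ-joins₁ 0 R (lit tt) (P<2m R) (τ 0 R ∂₁.α⟨ across 0 (lit tt) ⟩ τ 1 L ∂₁.β⟨ y-chord L ⟩ P R ∂₁.■)
    ∷ τ-joins₁ 1 L (lit tt) (P<2m R) (τ 1 L ∂₁.β⟨ y-chord L ⟩ P R ∂₁.■)
    ∷ τ-joins₁ 1 R (lit tt) (P<2m L) (τ 1 R ∂₁.β⟨ y-chord R ⟩ P L ∂₁.■)
    ∷ τ-joins₁ 2 L (lit tt) (P<2m L) (τ 2 L ∂₁.α⟨ across′ 1 (lit tt) ⟩ τ 1 R ∂₁.β⟨ y-chord R ⟩ P L ∂₁.■)
    ∷ τ-joins₁ 2 R (lit tt) (P<2m R)
        (τ 2 R ∂₁.α⟨ across 2 (lit tt) ⟩ τ 3 L ∂₁.β⟨ x-chord′ L ⟩ τ 0 R ∂₁.α⟨ across 0 (lit tt) ⟩ τ 1 L ∂₁.β⟨ y-chord L ⟩ P R ∂₁.■)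
    ∷ τ-joins₁ 3 L (lit tt) (P<2m R) (τ 3 L ∂₁.β⟨ x-chord′ L ⟩ τ 0 R ∂₁.α⟨ across 0 (lit tt) ⟩ τ 1 L ∂₁.β⟨ y-chord L ⟩ P R ∂₁.■)
    ∷ τ-joins₁ 3 R (lit tt) lastRight<2m (τ 3 R ∂₁.β⟨ x-chord′ R ⟩ τ 0 L ∂₁.α⟨ leave ⟩ lastRight ∂₁.■)
    ∷ τ-joins₁ 4 L (lit tt) lastRight<2m
        (τ 4 L ∂₁.α⟨ across′ 3 (lit tt) ⟩ τ 3 R ∂₁.β⟨ x-chord′ R ⟩ τ 0 L ∂₁.α⟨ leave ⟩ lastRight ∂₁.■)
    ∷ τ-joins₁ 4 R (lit tt) 0<2m (τ 4 R ∂₁.α⟨ wrap ⟩ 0 ∂₁.■)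
    ∷ []

  tail-reps₂ : All (λ z → isRep E₂.W E₂.k z ≡ false) (sides m 1)
  tail-reps₂ = τ-joins₂ 0 L (lit tt) lastRight<2m (τ 0 L ∂₂.α⟨ leave₂ ⟩ lastRight ∂₂.■)
             ∷ τ-joins₂ 0 R (lit tt) 0<2m (τ 0 R ∂₂.α⟨ wrap₂ ⟩ 0 ∂₂.■)
             ∷ []

  boundaryComponents-≡ : boundaryComponents E₁.W ≡ boundaryComponents E₂.W
  boundaryComponents-≡ = boundaryComponents-preserved h₁₂ h₂₁ sim₁₂ sim₂₁ tail-reps₁ tail-reps₂

private
  loneLoop : ℕ → ℕ → ℕ
  loneLoop e zero    = 0
  loneLoop e (suc _) = e

  loneLoop-injective : ∀ {e} → e ≢ 0 → ∀ {i j} → i ≤ 1 → j ≤ 1 → loneLoop e i ≡ loneLoop e j → i ≡ j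
  loneLoop-injective e≢0 {zero}  {zero}  _         _         _  = refl
  loneLoop-injective e≢0 {zero}  {suc _} _         _         eq = ⊥-elim (e≢0 (sym eq))
  loneLoop-injective e≢0 {suc _} {zero}  _         _         eq = ⊥-elim (e≢0 eq)
  loneLoop-injective e≢0 {suc zero} {suc zero} _   _         _  = refl
  loneLoop-injective e≢0 {suc (suc _)} (s≤s ()) _ _
  loneLoop-injective e≢0 {suc zero} {suc (suc _)} _ (s≤s ()) _

  handle : ℕ → ℕ → ℕ → ℕ
  handle x e zero          = 0
  handle x e (suc zero)    = x
  handle x e (suc (suc _)) = e

  handle-injective : ∀ {x e} → x ≢ 0 → e ≢ 0 → x ≢ e →
                     ∀ {i j} → i ≤ 2 → j ≤ 2 → handle x e i ≡ handle x e j → i ≡ j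
  handle-injective x≢0 e≢0 x≢e {0} {0} _ _ _ = refl
  handle-injective x≢0 e≢0 x≢e {0} {1} _ _ eq = ⊥-elim (x≢0 (sym eq))
  handle-injective x≢0 e≢0 x≢e {0} {2} _ _ eq = ⊥-elim (e≢0 (sym eq))
  handle-injective x≢0 e≢0 x≢e {1} {0} _ _ eq = ⊥-elim (x≢0 eq)
  handle-injective x≢0 e≢0 x≢e {1} {1} _ _ _ = refl
  handle-injective x≢0 e≢0 x≢e {1} {2} _ _ eq = ⊥-elim (x≢e eq)
  handle-injective x≢0 e≢0 x≢e {2} {0} _ _ eq = ⊥-elim (e≢0 eq)
  handle-injective x≢0 e≢0 x≢e {2} {1} _ _ eq = ⊥-elim (x≢e (sym eq))
  handle-injective x≢0 e≢0 x≢e {2} {2} _ _ _ = refl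
  handle-injective x≢0 e≢0 x≢e {suc (suc (suc _))} (s≤s (s≤s ())) _ _
  handle-injective x≢0 e≢0 x≢e {_} {suc (suc (suc _))} _ (s≤s (s≤s ())) _

boundaryComponents-twistedLoop-alone : ∀ {e} → e ≢ 0 → boundaryComponents ((e , true) ∷ (e , false) ∷ []) ≡ 1
boundaryComponents-twistedLoop-alone {e} e≢0 =
  trans (boundaryComponents-rename (loneLoop e) ((1 , true) ∷ (1 , false) ∷ []) ((e , true) ∷ (e , false) ∷ []) 1 refl refl
           (≤-refl ∷ ≤-refl ∷ []) (loneLoop-injective e≢0)) refl

boundaryComponents-untwistedLoop-alone : ∀ {e} → e ≢ 0 → boundaryComponents ((e , true) ∷ (e , true) ∷ []) ≡ 2
boundaryComponents-untwistedLoop-alone {e} e≢0 =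
  trans (boundaryComponents-rename (loneLoop e) ((1 , true) ∷ (1 , true) ∷ []) ((e , true) ∷ (e , true) ∷ []) 1 refl refl
           (≤-refl ∷ ≤-refl ∷ []) (loneLoop-injective e≢0)) refl

boundaryComponents-handle-alone : ∀ {x e} → x ≢ 0 → e ≢ 0 → x ≢ e →
  boundaryComponents ((x , true) ∷ (e , true) ∷ (x , true) ∷ (e , true) ∷ []) ≡ 1
boundaryComponents-handle-alone {x} {e} x≢0 e≢0 x≢e =
  trans (boundaryComponents-rename (handle x e) ((1 , true) ∷ (2 , true) ∷ (1 , true) ∷ (2 , true) ∷ [])
           ((x , true) ∷ (e , true) ∷ (x , true) ∷ (e , true) ∷ []) 2 refl refl
           (s≤s z≤n ∷ ≤-refl ∷ s≤s z≤n ∷ ≤-refl ∷ []) (handle-injective x≢0 e≢0 x≢e)) refl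

AllPositive : SignedRotation → Set
AllPositive = All (λ x → proj₂ x ≡ true)

sign-positive : ∀ r {p} → AllPositive r → p < length r → sign r p ≡ true
sign-positive (x ∷ r) {zero}  (pos ∷ _)  _   = pos
sign-positive (x ∷ r) {suc p} (_ ∷ pos) p<r = sign-positive r pos (≤-pred p<r)

private
  WellFormed-++[] : ∀ u → WellFormed u → WellFormed (u ++ [])
  WellFormed-++[] u = subst WellFormed (sym (++-identityʳ u))

  boundaryComponents-++[] : ∀ u → boundaryComponents (u ++ []) ≡ boundaryComponents u
  boundaryComponents-++[] u = cong boundaryComponents (++-identityʳ u)

boundaryComponents-twistedLoop : ∀ u e → e ≢ 0 →
  WellFormed (u ++ (e , true) ∷ (e , false) ∷ []) → WellFormed u → multiplicity u e ≡ 0 →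
  boundaryComponents (u ++ (e , true) ∷ (e , false) ∷ []) ≡ boundaryComponents u
boundaryComponents-twistedLoop []       e e≢0 _   _   _     = boundaryComponents-twistedLoop-alone e≢0
boundaryComponents-twistedLoop (a ∷ u′) e _   wf₁ wf₂ fresh =
  trans (TwistedLoop.boundaryComponents-≡ a u′ e wf₁ (WellFormed-++[] (a ∷ u′) wf₂) fresh)
        (boundaryComponents-++[] (a ∷ u′))

boundaryComponents-untwistedLoop : ∀ u e → e ≢ 0 →
  WellFormed (u ++ (e , true) ∷ (e , true) ∷ []) → WellFormed u → multiplicity u e ≡ 0 →
  boundaryComponents (u ++ (e , true) ∷ (e , true) ∷ []) ≡ boundaryComponents u + 1
boundaryComponents-untwistedLoop []       e e≢0 _   _   _     = boundaryComponents-untwistedLoop-alone e≢0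
boundaryComponents-untwistedLoop (a ∷ u′) e _   wf₁ wf₂ fresh =
  trans (UntwistedLoop.boundaryComponents-≡+1 a u′ e wf₁ (WellFormed-++[] (a ∷ u′) wf₂) fresh)
        (cong (_+ 1) (boundaryComponents-++[] (a ∷ u′)))

boundaryComponents-handle : ∀ u x e → x ≢ 0 → e ≢ 0 → x ≢ e →
  WellFormed (u ++ (x , true) ∷ (e , true) ∷ (x , true) ∷ (e , true) ∷ []) → WellFormed u →
  multiplicity u x ≡ 0 → multiplicity u e ≡ 0 →
  boundaryComponents (u ++ (x , true) ∷ (e , true) ∷ (x , true) ∷ (e , true) ∷ []) ≡ boundaryComponents u
boundaryComponents-handle []       x e x≢0 e≢0 x≢e _   _   _       _       = boundaryComponents-handle-alone x≢0 e≢0 x≢e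
boundaryComponents-handle (a ∷ u′) x e _   _   _   wf₁ wf₂ fresh-x fresh-e =
  trans (Handle.boundaryComponents-≡ a u′ x e wf₁ (WellFormed-++[] (a ∷ u′) wf₂) fresh-x fresh-e)
        (boundaryComponents-++[] (a ∷ u′))

boundaryComponents-twistedLoopOverChord : ∀ u e x →
  WellFormed (u ++ (e , true) ∷ (x , true) ∷ (e , false) ∷ []) → WellFormed (u ++ (x , false) ∷ []) →
  multiplicity u e ≡ 0 → multiplicity u x ≡ 1 → AllPositive u →
  boundaryComponents (u ++ (e , true) ∷ (x , true) ∷ (e , false) ∷ []) ≡ boundaryComponents (u ++ (x , false) ∷ [])
boundaryComponents-twistedLoopOverChord (a ∷ u′) e x wf₁ wf₂ fresh once pos
  with multiplicity≥1⇒occurrence (a ∷ u′) (≤-reflexive (sym once))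
... | px , px<m , px-label =
  TwistedLoopOverChord.boundaryComponents-≡ a u′ e x px wf₁ wf₂ fresh once px<m px-label (sign-positive (a ∷ u′) pos px<m)

boundaryComponents-handleOverChord : ∀ u x y e →
  WellFormed (u ++ (x , true) ∷ (y , true) ∷ (e , true) ∷ (x , true) ∷ (e , true) ∷ []) →
  WellFormed (u ++ (y , true) ∷ []) →
  multiplicity u x ≡ 0 → multiplicity u y ≡ 1 → multiplicity u e ≡ 0 → AllPositive u →
  boundaryComponents (u ++ (x , true) ∷ (y , true) ∷ (e , true) ∷ (x , true) ∷ (e , true) ∷ []) ≡
  boundaryComponents (u ++ (y , true) ∷ [])
boundaryComponents-handleOverChord (a ∷ u′) x y e wf₁ wf₂ fresh-x once-y fresh-e pos
  with multiplicity≥1⇒occurrence (a ∷ u′) (≤-reflexive (sym once-y))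
... | py , py<m , py-label =
  HandleOverChord.boundaryComponents-≡ a u′ x y e py wf₁ wf₂ fresh-x once-y fresh-e py<m py-label
                                       (sign-positive (a ∷ u′) pos py<m)

-- The bouquets F′ⁿₙ and Fⁿₙ and their spanning subgraphs

block : ℕ → SignedRotation
block j = (4 + j , true) ∷ (3 + j , true) ∷ []

body : ℕ → SignedRotation
body j = ((1 , true) ∷ (2 , true) ∷ (3 , true) ∷ (2 , true) ∷ (1 , true) ∷ []) ++ concatMap block (upTo j)

-- For n = 3 + j, bouquet j false is F′ⁿₙ and bouquet j true is the orientable bouquet Fⁿₙ
-- obtained by untwisting edge n.
bouquet : ℕ → Bool → SignedRotation
bouquet j s = body j ++ (3 + j , s) ∷ []

Fprime≡bouquet : ∀ j → Fprime (3 + j) ≡ bouquet j false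
Fprime≡bouquet j =
  sym (++-assoc ((1 , true) ∷ (2 , true) ∷ (3 , true) ∷ (2 , true) ∷ (1 , true) ∷ []) (concatMap block (upTo j)) _)

body-suc : ∀ j → body (suc j) ≡ body j ++ block j
body-suc j = begin
  base ++ concatMap block (upTo (suc j))        ≡⟨ cong (λ l → base ++ concatMap block l) (upTo-∷ʳ j) ⟨
  base ++ concatMap block (upTo j ++ j ∷ [])    ≡⟨ cong (base ++_) (concatMap-++ block (upTo j) (j ∷ [])) ⟩
  base ++ (concatMap block (upTo j) ++ block j) ≡⟨ ++-assoc base (concatMap block (upTo j)) (block j) ⟨
  body j ++ block j                             ∎
  where
  open ≡-Reasoning
  base = (1 , true) ∷ (2 , true) ∷ (3 , true) ∷ (2 , true) ∷ (1 , true) ∷ []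

multiplicity-body-suc : ∀ j l → multiplicity (body (suc j)) l ≡ multiplicity (body j) l + multiplicity (block j) l
multiplicity-body-suc j l = trans (cong (λ w → multiplicity w l) (body-suc j)) (multiplicity-++ (body j) (block j) l)

multiplicity-body-above : ∀ j {l} → 3 + j < l → multiplicity (body j) l ≡ 0
multiplicity-body-above zero    {suc (suc (suc (suc l)))} _ = refl
multiplicity-body-above zero    {suc (suc (suc zero))} (s≤s (s≤s (s≤s ())))
multiplicity-body-above zero    {suc (suc zero)} (s≤s (s≤s ()))
multiplicity-body-above zero    {suc zero} (s≤s ())
multiplicity-body-above (suc j) {l} 4+j<l = begin
  multiplicity (body (suc j)) l                      ≡⟨ multiplicity-body-suc j l ⟩
  multiplicity (body j) l + multiplicity (block j) l ≡⟨ cong₂ _+_ (multiplicity-body-above j (<-trans (n<1+n _) 4+j<l))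
                                                                  (multiplicity-absent (block j) (<⇒≢ 4+j<l ∷ <⇒≢ (<-trans (n<1+n _) 4+j<l) ∷ [])) ⟩
  0                                                  ∎
  where open ≡-Reasoning

multiplicity-body-zero : ∀ j → multiplicity (body j) 0 ≡ 0
multiplicity-body-zero zero    = refl
multiplicity-body-zero (suc j) = trans (multiplicity-body-suc j 0) (cong₂ _+_ (multiplicity-body-zero j) refl)

multiplicity-block-4+j : ∀ j → multiplicity (block j) (4 + j) ≡ 1
multiplicity-block-4+j j = trans (multiplicity-here {4 + j} true ((3 + j , true) ∷ []) refl)
                                 (cong suc (multiplicity-absent ((3 + j , true) ∷ []) (<⇒≢ (n<1+n _) ∷ [])))

multiplicity-block-3+j : ∀ j → multiplicity (block j) (3 + j) ≡ 1
multiplicity-block-3+j j = trans (multiplicity-there {4 + j} {3 + j} true ((3 + j , true) ∷ []) (<⇒≢ (n<1+n _) ∘ sym))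
                                 (multiplicity-here {3 + j} true [] refl)

multiplicity-body-top : ∀ j → multiplicity (body j) (3 + j) ≡ 1
multiplicity-body-top zero    = refl
multiplicity-body-top (suc j) = begin
  multiplicity (body (suc j)) (4 + j)                            ≡⟨ multiplicity-body-suc j (4 + j) ⟩
  multiplicity (body j) (4 + j) + multiplicity (block j) (4 + j) ≡⟨ cong₂ _+_ (multiplicity-body-above j (n<1+n _)) (multiplicity-block-4+j j) ⟩
  1                                                              ∎
  where open ≡-Reasoning

multiplicity-body-below : ∀ j {l} → 1 ≤ l → l < 3 + j → multiplicity (body j) l ≡ 2
multiplicity-body-below zero    {1} _ _ = refl
multiplicity-body-below zero    {2} _ _ = refl
multiplicity-body-below zero    {suc (suc (suc _))} _ (s≤s (s≤s (s≤s ())))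
multiplicity-body-below (suc j) {l} 1≤l l<4+j with m≤n⇒m<n∨m≡n (≤-pred l<4+j)
... | inj₁ l<3+j = begin
  multiplicity (body (suc j)) l                      ≡⟨ multiplicity-body-suc j l ⟩
  multiplicity (body j) l + multiplicity (block j) l ≡⟨ cong₂ _+_ (multiplicity-body-below j 1≤l l<3+j)
      (multiplicity-absent (block j) ((<⇒≢ (<-trans l<3+j (n<1+n _)) ∘ sym) ∷ (<⇒≢ l<3+j ∘ sym) ∷ [])) ⟩
  2                                                  ∎
  where open ≡-Reasoning
... | inj₂ refl = begin
  multiplicity (body (suc j)) (3 + j)                            ≡⟨ multiplicity-body-suc j (3 + j) ⟩
  multiplicity (body j) (3 + j) + multiplicity (block j) (3 + j) ≡⟨ cong₂ _+_ (multiplicity-body-top j) (multiplicity-block-3+j j) ⟩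
  2                                                              ∎
  where open ≡-Reasoning

body-labels≤ : ∀ j → All (λ x → proj₁ x ≤ 3 + j) (body j)
body-labels≤ zero    = s≤s z≤n ∷ s≤s (s≤s z≤n) ∷ ≤-refl ∷ s≤s (s≤s z≤n) ∷ s≤s z≤n ∷ []
body-labels≤ (suc j) = subst (All (λ x → proj₁ x ≤ 4 + j)) (sym (body-suc j))
  (++⁺ (All.map (λ l≤ → ≤-trans l≤ (n≤1+n _)) (body-labels≤ j)) (≤-refl ∷ n≤1+n _ ∷ []))

body-positive : ∀ j → AllPositive (body j)
body-positive zero    = refl ∷ refl ∷ refl ∷ refl ∷ refl ∷ []
body-positive (suc j) = subst AllPositive (sym (body-suc j)) (++⁺ (body-positive j) (refl ∷ refl ∷ []))

sideBool : Side → Bool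
sideBool inside  = true
sideBool outside = false

memb-∷ʳ : ∀ {n} (F : Subset n) b {l} → l ≤ n → memb (F ∷ʳ b) l ≡ memb F l
memb-∷ʳ []            b {zero}        _   = refl
memb-∷ʳ (_ ∷ F)       b {zero}        _   = refl
memb-∷ʳ (inside ∷ F)  b {suc zero}    _   = refl
memb-∷ʳ (outside ∷ F) b {suc zero}    _   = refl
memb-∷ʳ (inside ∷ F)  b {suc (suc l)} l≤n = memb-∷ʳ F b (≤-pred l≤n)
memb-∷ʳ (outside ∷ F) b {suc (suc l)} l≤n = memb-∷ʳ F b (≤-pred l≤n)

memb-∷ʳ-last : ∀ {n} (F : Subset n) b → memb (F ∷ʳ b) (suc n) ≡ sideBool b
memb-∷ʳ-last []            inside  = refl
memb-∷ʳ-last []            outside = refl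
memb-∷ʳ-last (inside ∷ F)  b       = memb-∷ʳ-last F b
memb-∷ʳ-last (outside ∷ F) b       = memb-∷ʳ-last F b

restrict-∷ : ∀ {n} (F : Subset n) l s w → restrict F ((l , s) ∷ w) ≡ (if memb F l then (l , s) ∷ restrict F w else restrict F w)
restrict-∷ F l s w with memb F l
... | true  = refl
... | false = refl

restrict-++ : ∀ {n} (F : Subset n) u w → restrict F (u ++ w) ≡ restrict F u ++ restrict F w
restrict-++ F u w = filter-++ _ u w

keep : List Bool → SignedRotation → SignedRotation
keep (true  ∷ bs) (x ∷ w) = x ∷ keep bs w
keep (false ∷ bs) (x ∷ w) = keep bs w
keep _            _       = []

restrict≡keep : ∀ {n} (F : Subset n) w → restrict F w ≡ keep (map (memb F ∘ proj₁) w) w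
restrict≡keep F []            = refl
restrict≡keep F ((l , s) ∷ w) rewrite restrict-∷ F l s w with memb F l
... | true  = cong ((l , s) ∷_) (restrict≡keep F w)
... | false = restrict≡keep F w

restrict-cong : ∀ {n n′} (F : Subset n) (G : Subset n′) w →
  All (λ x → memb F (proj₁ x) ≡ memb G (proj₁ x)) w → restrict F w ≡ restrict G w
restrict-cong F G w same =
  trans (restrict≡keep F w) (trans (cong (λ bs → keep bs w) (map-cong-local same)) (sym (restrict≡keep G w)))

restrict-∷ʳ-body : ∀ j {N} (F : Subset N) b → 3 + j ≤ N → restrict (F ∷ʳ b) (body j) ≡ restrict F (body j)
restrict-∷ʳ-body j F b 3+j≤N =
  restrict-cong (F ∷ʳ b) F (body j) (All.map (λ l≤ → memb-∷ʳ F b (≤-trans l≤ 3+j≤N)) (body-labels≤ j))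

multiplicity-restrict : ∀ {n} (F : Subset n) w l → multiplicity (restrict F w) l ≡ (if memb F l then multiplicity w l else 0)
multiplicity-restrict F []            l with memb F l
... | true  = refl
... | false = refl
multiplicity-restrict F ((a , s) ∷ w) l rewrite restrict-∷ F a s w with a ≟ l
... | yes refl with memb F a in m
...   | true  = trans (multiplicity-here s (restrict F w) refl)
                      (trans (cong suc (trans (multiplicity-restrict F w a) (cong (λ b → if b then multiplicity w a else 0) m)))
                             (sym (multiplicity-here s w refl)))
...   | false = trans (multiplicity-restrict F w a) (cong (λ b → if b then multiplicity w a else 0) m)
multiplicity-restrict F ((a , s) ∷ w) l | no a≢l with memb F a
... | true  = trans (multiplicity-there s (restrict F w) a≢l)
                    (trans (multiplicity-restrict F w l) (cong (λ c → if memb F l then c else 0) (sym (multiplicity-there s w a≢l))))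
... | false = trans (multiplicity-restrict F w l) (cong (λ c → if memb F l then c else 0) (sym (multiplicity-there s w a≢l)))

positive-restrict : ∀ {n} (F : Subset n) w → AllPositive w → AllPositive (restrict F w)
positive-restrict F []            []           = []
positive-restrict F ((l , s) ∷ w) (pos ∷ poss) rewrite restrict-∷ F l s w with memb F l
... | true  = pos ∷ positive-restrict F w poss
... | false = positive-restrict F w poss

ZeroOrTwo : SignedRotation → Set
ZeroOrTwo r = ∀ l → multiplicity r l ≡ 0 ⊎ multiplicity r l ≡ 2

ZeroOrTwo⇒WellFormed : ∀ r → ZeroOrTwo r → WellFormed r
ZeroOrTwo⇒WellFormed r zero-or-two p p< with zero-or-two (label r p)
... | inj₂ two  = two
... | inj₁ none = ⊥-elim (<-irrefl (sym none) (occurrence⇒multiplicity≥1 r (p< , refl)))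

bouquet-zeroOrTwo : ∀ j s → ZeroOrTwo (bouquet j s)
bouquet-zeroOrTwo j s l rewrite multiplicity-++ (body j) ((3 + j , s) ∷ []) l with <-cmp l (3 + j)
... | tri≈ _ refl _ rewrite multiplicity-body-top j | multiplicity-here {3 + j} s [] refl = inj₂ refl
... | tri> _ _ l>   rewrite multiplicity-body-above j l> | multiplicity-there {3 + j} s [] (<⇒≢ l>) = inj₁ refl
... | tri< l< _ _   rewrite multiplicity-there {3 + j} s [] (<⇒≢ l< ∘ sym) with l
...   | zero    rewrite multiplicity-body-zero j = inj₁ refl
...   | suc l′  rewrite multiplicity-body-below j (s≤s z≤n) l< = inj₂ refl

restrict-bouquet-wellFormed : ∀ j s {N} (F : Subset N) → WellFormed (restrict F (bouquet j s))
restrict-bouquet-wellFormed j s F = ZeroOrTwo⇒WellFormed (restrict F (bouquet j s)) zero-or-two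
  where
  zero-or-two : ZeroOrTwo (restrict F (bouquet j s))
  zero-or-two l rewrite multiplicity-restrict F (bouquet j s) l with memb F l
  ... | true  = bouquet-zeroOrTwo j s l
  ... | false = inj₁ refl

restrict-bouquet≡⇒WellFormed : ∀ j s {N} (F : Subset N) {w} → restrict F (bouquet j s) ≡ w → WellFormed w
restrict-bouquet≡⇒WellFormed j s F eq = subst WellFormed eq (restrict-bouquet-wellFormed j s F)

multiplicity-restrict-body-above : ∀ j {N} (F : Subset N) {l} → 3 + j < l → multiplicity (restrict F (body j)) l ≡ 0
multiplicity-restrict-body-above j F {l} l> rewrite multiplicity-restrict F (body j) l with memb F l
... | true  = multiplicity-body-above j l>
... | false = refl

multiplicity-restrict-body-top : ∀ j {N} (F : Subset N) → memb F (3 + j) ≡ true → multiplicity (restrict F (body j)) (3 + j) ≡ 1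
multiplicity-restrict-body-top j F in-F rewrite multiplicity-restrict F (body j) (3 + j) | in-F = multiplicity-body-top j

countSubsets : ∀ n → (Subset n → Bool) → ℕ
countSubsets n P = countTrue (map P (allSubsets n))

countSubsets-cong : ∀ n {P Q : Subset n → Bool} → (∀ F → P F ≡ Q F) → countSubsets n P ≡ countSubsets n Q
countSubsets-cong n P≗Q = cong countTrue (map-cong P≗Q (allSubsets n))

countSubsets-none : ∀ n {P : Subset n → Bool} → (∀ F → P F ≡ false) → countSubsets n P ≡ 0
countSubsets-none n {P} none = trans (countSubsets-cong n none) (countTrue-false (allSubsets n))
  where
  countTrue-false : ∀ {A : Set} (xs : List A) → countTrue (map (λ _ → false) xs) ≡ 0
  countTrue-false []       = refl
  countTrue-false (_ ∷ xs) = countTrue-false xs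

countSubsets-∷ : ∀ n (P : Subset (suc n) → Bool) →
  countSubsets (suc n) P ≡ countSubsets n (P ∘ (inside ∷_)) + countSubsets n (P ∘ (outside ∷_))
countSubsets-∷ n P = begin
  countTrue (map P (map (inside ∷_) S ++ map (outside ∷_) S))                 ≡⟨ cong countTrue (map-++ P (map (inside ∷_) S) _) ⟩
  countTrue (map P (map (inside ∷_) S) ++ map P (map (outside ∷_) S))         ≡⟨ countTrue-++ (map P (map (inside ∷_) S)) _ ⟩
  countTrue (map P (map (inside ∷_) S)) + countTrue (map P (map (outside ∷_) S))
    ≡⟨ cong₂ _+_ (cong countTrue (sym (map-∘ S))) (cong countTrue (sym (map-∘ S))) ⟩
  countSubsets n (P ∘ (inside ∷_)) + countSubsets n (P ∘ (outside ∷_))        ∎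
  where
  open ≡-Reasoning
  S = allSubsets n

countSubsets-∷ʳ : ∀ n (P : Subset (suc n) → Bool) →
  countSubsets (suc n) P ≡ countSubsets n (P ∘ (_∷ʳ inside)) + countSubsets n (P ∘ (_∷ʳ outside))
countSubsets-∷ʳ zero    P = countSubsets-∷ zero P
countSubsets-∷ʳ (suc n) P = begin
  countSubsets (2 + n) P                                              ≡⟨ countSubsets-∷ (suc n) P ⟩
  countSubsets (suc n) (P ∘ (inside ∷_)) + countSubsets (suc n) (P ∘ (outside ∷_))
    ≡⟨ cong₂ _+_ (countSubsets-∷ʳ n (P ∘ (inside ∷_))) (countSubsets-∷ʳ n (P ∘ (outside ∷_))) ⟩
  (c inside inside + c inside outside) + (c outside inside + c outside outside) ≡⟨ interchange (c inside inside) (c inside outside) (c outside inside) (c outside outside) ⟩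
  (c inside inside + c outside inside) + (c inside outside + c outside outside)
    ≡⟨ cong₂ _+_ (countSubsets-∷ n (P ∘ (_∷ʳ inside))) (countSubsets-∷ n (P ∘ (_∷ʳ outside))) ⟨
  countSubsets (suc n) (P ∘ (_∷ʳ inside)) + countSubsets (suc n) (P ∘ (_∷ʳ outside)) ∎
  where
  open ≡-Reasoning
  c : Side → Side → ℕ
  c first last = countSubsets n (λ F → P (first ∷ (F ∷ʳ last)))

bouquet-suc : ∀ j s → bouquet (suc j) s ≡ body j ++ (4 + j , true) ∷ (3 + j , true) ∷ (4 + j , s) ∷ []
bouquet-suc j s = trans (cong (_++ (4 + j , s) ∷ []) (body-suc j)) (++-assoc (body j) (block j) _)

bouquet-suc-suc : ∀ j s →
  bouquet (2 + j) s ≡ body j ++ (4 + j , true) ∷ (3 + j , true) ∷ (5 + j , true) ∷ (4 + j , true) ∷ (5 + j , s) ∷ []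
bouquet-suc-suc j s = trans (bouquet-suc (suc j) s) (trans (cong (_++ t) (body-suc j)) (++-assoc (body j) (block j) t))
  where t = (5 + j , true) ∷ (4 + j , true) ∷ (5 + j , s) ∷ []

module Restriction (j : ℕ) (F : Subset (3 + j)) where

  u : SignedRotation
  u = restrict F (body j)

  memb-top : ∀ b → memb (F ∷ʳ b) (4 + j) ≡ sideBool b
  memb-top = memb-∷ʳ-last F

  memb-below-top : ∀ b → memb (F ∷ʳ b) (3 + j) ≡ memb F (3 + j)
  memb-below-top b = memb-∷ʳ F b ≤-refl

  restrict-bouquet : ∀ s {c} → memb F (3 + j) ≡ c → restrict F (bouquet j s) ≡ u ++ keep (c ∷ []) ((3 + j , s) ∷ [])
  restrict-bouquet s m = trans (restrict-++ F (body j) _) (cong (u ++_) (trans (restrict≡keep F _) (cong (λ c → keep (c ∷ []) _) m)))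

  restrict-bouquet-suc : ∀ b s {c} → memb F (3 + j) ≡ c →
    restrict (F ∷ʳ b) (bouquet (suc j) s) ≡ u ++ keep (sideBool b ∷ c ∷ sideBool b ∷ []) ((4 + j , true) ∷ (3 + j , true) ∷ (4 + j , s) ∷ [])
  restrict-bouquet-suc b s {c} m = begin
    restrict (F ∷ʳ b) (bouquet (suc j) s)                   ≡⟨ cong (restrict (F ∷ʳ b)) (bouquet-suc j s) ⟩
    restrict (F ∷ʳ b) (body j ++ t)                        ≡⟨ restrict-++ (F ∷ʳ b) (body j) t ⟩
    restrict (F ∷ʳ b) (body j) ++ restrict (F ∷ʳ b) t      ≡⟨ cong₂ _++_ (restrict-∷ʳ-body j F b ≤-refl) (restrict≡keep (F ∷ʳ b) t) ⟩
    u ++ keep (map (memb (F ∷ʳ b) ∘ proj₁) t) t            ≡⟨ cong (λ bs → u ++ keep bs t)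
                                                               (cong₂ _∷_ (memb-top b) (cong₂ _∷_ (trans (memb-below-top b) m) (cong₂ _∷_ (memb-top b) refl))) ⟩
    u ++ keep (sideBool b ∷ c ∷ sideBool b ∷ []) t         ∎
    where
    open ≡-Reasoning
    t = (4 + j , true) ∷ (3 + j , true) ∷ (4 + j , s) ∷ []

  restrict-bouquet-suc-outside : ∀ s → restrict (F ∷ʳ outside) (bouquet (suc j) s) ≡ restrict F (bouquet j true)
  restrict-bouquet-suc-outside s with memb F (3 + j) in m
  ... | true  = trans (restrict-bouquet-suc outside s m) (sym (restrict-bouquet true m))
  ... | false = trans (restrict-bouquet-suc outside s m) (sym (restrict-bouquet true m))

  private
    fresh-above : multiplicity u (4 + j) ≡ 0
    fresh-above = multiplicity-restrict-body-above j F (n<1+n _)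

    fresh-above₂ : multiplicity u (5 + j) ≡ 0
    fresh-above₂ = multiplicity-restrict-body-above j F (<-trans (n<1+n _) (n<1+n _))

    u-positive : AllPositive u
    u-positive = positive-restrict F (body j) (body-positive j)

  isQuasiTree-inside : isQuasiTree (restrict (F ∷ʳ inside) (bouquet (suc j) false)) ≡ isQuasiTree (restrict F (bouquet j false))
  isQuasiTree-inside with memb F (3 + j) in m
  ... | true = begin
    isQuasiTree (restrict (F ∷ʳ inside) (bouquet (suc j) false))
      ≡⟨ cong isQuasiTree grown ⟩
    isQuasiTree (u ++ (4 + j , true) ∷ (3 + j , true) ∷ (4 + j , false) ∷ [])
      ≡⟨ cong (_≡ᵇ 1) (boundaryComponents-twistedLoopOverChord u (4 + j) (3 + j)
                        wf-grown wf-shrunk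
                        fresh-above (multiplicity-restrict-body-top j F m) u-positive) ⟩
    isQuasiTree (u ++ (3 + j , false) ∷ [])
      ≡⟨ cong isQuasiTree shrunk ⟨
    isQuasiTree (restrict F (bouquet j false))
      ∎
    where
    open ≡-Reasoning
    grown = restrict-bouquet-suc inside false m
    shrunk = restrict-bouquet false m
    wf-grown = restrict-bouquet≡⇒WellFormed (suc j) false (F ∷ʳ inside) grown
    wf-shrunk = restrict-bouquet≡⇒WellFormed j false F shrunk
  ... | false = begin
    isQuasiTree (restrict (F ∷ʳ inside) (bouquet (suc j) false))
      ≡⟨ cong isQuasiTree grown ⟩
    isQuasiTree (u ++ (4 + j , true) ∷ (4 + j , false) ∷ [])
      ≡⟨ cong (_≡ᵇ 1) (boundaryComponents-twistedLoop u (4 + j) (λ ())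
                        wf-grown wf-shrunk fresh-above) ⟩
    isQuasiTree u
      ≡⟨ cong isQuasiTree shrunk ⟨
    isQuasiTree (restrict F (bouquet j false))
      ∎
    where
    open ≡-Reasoning
    grown = restrict-bouquet-suc inside false m
    shrunk = trans (restrict-bouquet false m) (++-identityʳ u)
    wf-grown = restrict-bouquet≡⇒WellFormed (suc j) false (F ∷ʳ inside) grown
    wf-shrunk = restrict-bouquet≡⇒WellFormed j false F shrunk

  isQuasiTree-untwistedLoop : memb F (3 + j) ≡ false → isQuasiTree (restrict (F ∷ʳ inside) (bouquet (suc j) true)) ≡ false
  isQuasiTree-untwistedLoop m = begin
    isQuasiTree (restrict (F ∷ʳ inside) (bouquet (suc j) true))
      ≡⟨ cong isQuasiTree grown ⟩
    isQuasiTree (u ++ (4 + j , true) ∷ (4 + j , true) ∷ [])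
      ≡⟨ cong (_≡ᵇ 1) (boundaryComponents-untwistedLoop u (4 + j) (λ ())
                        wf-grown wf-shrunk fresh-above) ⟩
    (boundaryComponents u + 1 ≡ᵇ 1)
      ≡⟨ ≢⇒≡ᵇ-false (λ eq → <-irrefl (sym eq) (+-monoˡ-< 1 (boundaryComponents≥1 u))) ⟩
    false
      ∎
    where
    open ≡-Reasoning
    grown = restrict-bouquet-suc inside true m
    shrunk = trans (restrict-bouquet true m) (++-identityʳ u)
    wf-grown = restrict-bouquet≡⇒WellFormed (suc j) true (F ∷ʳ inside) grown
    wf-shrunk = restrict-bouquet≡⇒WellFormed j true F shrunk

  restrict-bouquet-suc-suc : ∀ {c} → memb F (3 + j) ≡ c →
    restrict ((F ∷ʳ inside) ∷ʳ inside) (bouquet (2 + j) true) ≡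
    u ++ keep (true ∷ c ∷ true ∷ true ∷ true ∷ []) ((4 + j , true) ∷ (3 + j , true) ∷ (5 + j , true) ∷ (4 + j , true) ∷ (5 + j , true) ∷ [])
  restrict-bouquet-suc-suc {c} m = begin
    restrict F₂ (bouquet (2 + j) true)                  ≡⟨ cong (restrict F₂) (bouquet-suc-suc j true) ⟩
    restrict F₂ (body j ++ t)                           ≡⟨ restrict-++ F₂ (body j) t ⟩
    restrict F₂ (body j) ++ restrict F₂ t               ≡⟨ cong₂ _++_ body-part (restrict≡keep F₂ t) ⟩
    u ++ keep (map (memb F₂ ∘ proj₁) t) t               ≡⟨ cong (λ bs → u ++ keep bs t) (cong₂ _∷_ m4 (cong₂ _∷_ m3 (cong₂ _∷_ m5
                                                             (cong₂ _∷_ m4 (cong₂ _∷_ m5 refl))))) ⟩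
    u ++ keep (true ∷ c ∷ true ∷ true ∷ true ∷ []) t    ∎
    where
    open ≡-Reasoning
    F₂ = (F ∷ʳ inside) ∷ʳ inside
    t = (4 + j , true) ∷ (3 + j , true) ∷ (5 + j , true) ∷ (4 + j , true) ∷ (5 + j , true) ∷ []
    body-part = trans (restrict-∷ʳ-body j (F ∷ʳ inside) inside (n≤1+n _)) (restrict-∷ʳ-body j F inside ≤-refl)
    m5 = memb-∷ʳ-last (F ∷ʳ inside) inside
    m4 = trans (memb-∷ʳ (F ∷ʳ inside) inside ≤-refl) (memb-top inside)
    m3 = trans (memb-∷ʳ (F ∷ʳ inside) inside (n≤1+n _)) (trans (memb-below-top inside) m)

  isQuasiTree-inside-inside :
    isQuasiTree (restrict ((F ∷ʳ inside) ∷ʳ inside) (bouquet (2 + j) true)) ≡ isQuasiTree (restrict F (bouquet j true))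
  isQuasiTree-inside-inside with memb F (3 + j) in m
  ... | true = begin
    isQuasiTree (restrict ((F ∷ʳ inside) ∷ʳ inside) (bouquet (2 + j) true))
      ≡⟨ cong isQuasiTree grown ⟩
    isQuasiTree (u ++ (4 + j , true) ∷ (3 + j , true) ∷ (5 + j , true) ∷ (4 + j , true) ∷ (5 + j , true) ∷ [])
      ≡⟨ cong (_≡ᵇ 1) (boundaryComponents-handleOverChord u (4 + j) (3 + j) (5 + j)
                        wf-grown wf-shrunk
                        fresh-above (multiplicity-restrict-body-top j F m) fresh-above₂ u-positive) ⟩
    isQuasiTree (u ++ (3 + j , true) ∷ [])
      ≡⟨ cong isQuasiTree shrunk ⟨
    isQuasiTree (restrict F (bouquet j true))
      ∎
    where
    open ≡-Reasoning
    grown = restrict-bouquet-suc-suc m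
    shrunk = restrict-bouquet true m
    wf-grown = restrict-bouquet≡⇒WellFormed (2 + j) true ((F ∷ʳ inside) ∷ʳ inside) grown
    wf-shrunk = restrict-bouquet≡⇒WellFormed j true F shrunk
  ... | false = begin
    isQuasiTree (restrict ((F ∷ʳ inside) ∷ʳ inside) (bouquet (2 + j) true))
      ≡⟨ cong isQuasiTree grown ⟩
    isQuasiTree (u ++ (4 + j , true) ∷ (5 + j , true) ∷ (4 + j , true) ∷ (5 + j , true) ∷ [])
      ≡⟨ cong (_≡ᵇ 1) (boundaryComponents-handle u (4 + j) (5 + j) (λ ()) (λ ()) (<⇒≢ (n<1+n _))
                        wf-grown wf-shrunk fresh-above fresh-above₂) ⟩
    isQuasiTree u
      ≡⟨ cong isQuasiTree shrunk ⟨
    isQuasiTree (restrict F (bouquet j true))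
      ∎
    where
    open ≡-Reasoning
    grown = restrict-bouquet-suc-suc m
    shrunk = trans (restrict-bouquet true m) (++-identityʳ u)
    wf-grown = restrict-bouquet≡⇒WellFormed (2 + j) true ((F ∷ʳ inside) ∷ʳ inside) grown
    wf-shrunk = restrict-bouquet≡⇒WellFormed j true F shrunk

-- The Lucas recurrences

κ′ κ : ℕ → ℕ
κ′ j = kappa (3 + j) (bouquet j false)
κ  j = kappa (3 + j) (bouquet j true)

κ′-suc : ∀ j → κ′ (suc j) ≡ κ′ j + κ j
κ′-suc j = begin
  κ′ (suc j)                                                                          ≡⟨ countSubsets-∷ʳ (3 + j) P ⟩
  countSubsets (3 + j) (P ∘ (_∷ʳ inside)) + countSubsets (3 + j) (P ∘ (_∷ʳ outside))  ≡⟨ cong₂ _+_ last-inside last-outside ⟩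
  κ′ j + κ j                                                                          ∎
  where
  open ≡-Reasoning
  P : Subset (4 + j) → Bool
  P F = isQuasiTree (restrict F (bouquet (suc j) false))
  last-inside : countSubsets (3 + j) (P ∘ (_∷ʳ inside)) ≡ κ′ j
  last-inside = countSubsets-cong (3 + j) (λ F → Restriction.isQuasiTree-inside j F)
  last-outside : countSubsets (3 + j) (P ∘ (_∷ʳ outside)) ≡ κ j
  last-outside = countSubsets-cong (3 + j) (λ F → cong isQuasiTree (Restriction.restrict-bouquet-suc-outside j F false))

κ-suc-suc : ∀ j → κ (2 + j) ≡ κ (1 + j) + κ j
κ-suc-suc j = begin
  κ (2 + j)
    ≡⟨ countSubsets-∷ʳ (4 + j) P ⟩
  countSubsets (4 + j) (P ∘ (_∷ʳ inside)) + countSubsets (4 + j) (P ∘ (_∷ʳ outside))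
    ≡⟨ cong (_+ countSubsets (4 + j) (P ∘ (_∷ʳ outside))) (countSubsets-∷ʳ (3 + j) (P ∘ (_∷ʳ inside))) ⟩
  (countSubsets (3 + j) (P ∘ (_∷ʳ inside) ∘ (_∷ʳ inside)) + countSubsets (3 + j) (P ∘ (_∷ʳ inside) ∘ (_∷ʳ outside)))
    + countSubsets (4 + j) (P ∘ (_∷ʳ outside))
    ≡⟨ cong₂ _+_ (cong₂ _+_ both-inside untwisted) last-outside ⟩
  (κ j + 0) + κ (1 + j)
    ≡⟨ trans (cong (_+ κ (1 + j)) (+-identityʳ (κ j))) (+-comm (κ j) (κ (1 + j))) ⟩
  κ (1 + j) + κ j
    ∎
  where
  open ≡-Reasoning
  P : Subset (5 + j) → Bool
  P F = isQuasiTree (restrict F (bouquet (2 + j) true))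
  both-inside : countSubsets (3 + j) (P ∘ (_∷ʳ inside) ∘ (_∷ʳ inside)) ≡ κ j
  both-inside = countSubsets-cong (3 + j) (λ G → Restriction.isQuasiTree-inside-inside j G)
  untwisted : countSubsets (3 + j) (P ∘ (_∷ʳ inside) ∘ (_∷ʳ outside)) ≡ 0
  untwisted = countSubsets-none (3 + j) (λ G → Restriction.isQuasiTree-untwistedLoop (suc j) (G ∷ʳ outside) (memb-∷ʳ-last G outside))
  last-outside : countSubsets (4 + j) (P ∘ (_∷ʳ outside)) ≡ κ (1 + j)
  last-outside = countSubsets-cong (4 + j) (λ F → cong isQuasiTree (Restriction.restrict-bouquet-suc-outside (suc j) F true))

κ≡lucas : ∀ j → κ j ≡ lucas (2 + j)
κ≡lucas zero          = refl
κ≡lucas (suc zero)    = refl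
κ≡lucas (suc (suc j)) = trans (κ-suc-suc j) (cong₂ _+_ (κ≡lucas (suc j)) (κ≡lucas j))

κ′≡lucas : ∀ j → κ′ j ≡ lucas (3 + j)
κ′≡lucas zero    = refl
κ′≡lucas (suc j) = trans (κ′-suc j) (cong₂ _+_ (κ′≡lucas j) (κ≡lucas j))

theorem5p4 : (n : ℕ) → 3 ≤ n → kappa n (Fprime n) ≡ lucas n
theorem5p4 (suc (suc (suc j))) (s≤s (s≤s (s≤s z≤n))) = trans (cong (kappa (3 + j)) (Fprime≡bouquet j)) (κ′≡lucas j)
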